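{- Let $T$ be a finite tree with root $r$, positive edge weights, a real $B>1$ such that every vertex is at distance at most $B/2$ from $r$, and a fixed depth first search traversal $R_{\mathrm{DFS}}$ of $T$. Let $v$ be any vertex of $T$ and let $e_1,\dots,e_k$ be all downward edges of $v$. Then $$\mathrm{cost}(C_{\mathrm{opt}}(T_v))=\sum_{i=1}^k \mathrm{cost}(C_{\mathrm{opt}}(T_{e_i}))\quad\text{and}\quad \mathrm{cost}(\mathrm{ADFS}(T_v))\le \sum_{i=1}^k \mathrm{cost}(\mathrm{ADFS}(T_{e_i})).$$
   Context: The potential of a vertex $u$ is $\varphi(u)=B/2-d(r,u)$, where $d$ is the weighted tree distance. For an edge $e=\{u,w\}$ with $u$ the parent of $w$, $e$ is a downward edge of $u$. $T_v$ denotes the subtree consisting of $v$ and all its descendants, rooted at $v$; $T_e$ (for $e=\{u,w\}$, $u$ parent of $w$) denotes $T_w$ together with the edge $e$, rooted at $u$. For a subtree $T'$ with root $u$, the potential $\varphi(T')$ is $\varphi(u)$ and its budget is $\beta=2\varphi(u)$. A route in $T'$ is a closed walk in $T'$ starting and ending at $u$; its length is the sum of the weights of traversed edges (with multiplicity). A $\beta$-exploration strategy of $T'$ is a finite sequence of routes in $T'$, each of length at most $\beta$, together visiting all vertices of $T'$; its cost is the total length of its routes. $C_{\mathrm{opt}}(T')$ denotes a minimum cost $\beta$-exploration strategy of $T'$. The DFS traversal of $T'$ used is the restriction of $R_{\mathrm{DFS}}$ to $T'$ (a depth first traversal $(v_0,\dots,v_l)$ of $T'$ from $u$). For $0\le B'\le\beta$,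 the $B'$-adversarial DFS $\beta$-exploration $\mathrm{ADFS}_{B'}(T')=(R_1,\dots,R_k)$ is defined iteratively: $j_0=0$; $j_1$ is the largest $p\le l$ with $\mathrm{len}(v_0,\dots,v_p)+d(v_p,u)\le B'$; for $i\ge 2$, $j_i$ is the largest $p\le l$, $p\ge j_{i-1}$, with $d(u,v_{j_{i-1}})+\mathrm{len}(v_{j_{i-1}},\dots,v_p)+d(v_p,u)\le\beta$; $R_i$ is the path from $u$ to $v_{j_{i-1}}$, then the walk $(v_{j_{i-1}},\dots,v_{j_i})$, then the path from $v_{j_i}$ back to $u$; stop when $j_i=l$. Finally $\mathrm{cost}(\mathrm{ADFS}(T'))=\max_{0\le B'\le \beta}\mathrm{cost}(\mathrm{ADFS}_{B'}(T'))$.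
   Formalization: The edge weights, the number B, and the values B′ over which the maximum defining cost(ADFS) is taken are rational rather than real. -}

module Defs where

open import Data.Nat using (ℕ; zero; suc; _∸_) renaming (_≤_ to _≤ℕ_; _<_ to _<ℕ_)
open import Data.Rational using (ℚ; 0ℚ; ½; _+_; _-_; _*_; _≤_; _<_)
open import Data.List using (List; []; _∷_; _++_; [_]; map; foldr; length; take; drop; head; last)
open import Data.List.Relation.Unary.All using (All)
open import Data.List.Relation.Unary.Any using (Any)
open import Data.List.Membership.Propositional using (_∈_)
open import Data.Maybe using (Maybe; just; nothing)
open import Data.Product using (Σ; _×_; _,_; proj₁; proj₂)
open import Relation.Binary.PropositionalEquality using (_≡_; _≢_)
open import Relation.Nullary using (¬_)

-- Rooted trees with rational edge weights.
-- A vertex has an ordered list of children, each with the weight of the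
-- edge to it.  The order of the children fixes the DFS traversal R_DFS.

data Tree : Set where
  node : List (ℚ × Tree) → Tree

-- A vertex is addressed by the list of child indices on the path from the root.
Pos : Set
Pos = List ℕ

childAt : Tree → ℕ → Maybe (ℚ × Tree)
childAt (node cs) i = go cs i
  where
  go : List (ℚ × Tree) → ℕ → Maybe (ℚ × Tree)
  go []       _       = nothing
  go (c ∷ cs) zero    = just c
  go (_ ∷ cs) (suc i) = go cs i

mutual
  sub : Tree → Pos → Maybe Tree
  sub t         []      = just t
  sub (node cs) (i ∷ p) = subL cs i p

  subL : List (ℚ × Tree) → ℕ → Pos → Maybe Tree
  subL []             _       _ = nothing
  subL ((_ , t) ∷ cs) zero    p = sub t p
  subL (_ ∷ cs)       (suc i) p = subL cs i p

Vertex : Tree → Pos → Set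
Vertex t x = Σ Tree (λ s → sub t x ≡ just s)

-- weighted distance from the root (0 for non-vertices; only used on vertices)
mutual
  depth : Tree → Pos → ℚ
  depth t         []      = 0ℚ
  depth (node cs) (i ∷ p) = depthL cs i p

  depthL : List (ℚ × Tree) → ℕ → Pos → ℚ
  depthL []             _       _ = 0ℚ
  depthL ((w , t) ∷ cs) zero    p = w + depth t p
  depthL (_ ∷ cs)       (suc i) p = depthL cs i p

data Step (t : Tree) : Pos → Pos → ℚ → Set where
  down : ∀ {x s i w s'} → sub t x ≡ just s → childAt s i ≡ just (w , s') →
         Step t x (x ++ [ i ]) w
  up   : ∀ {x s i w s'} → sub t x ≡ just s → childAt s i ≡ just (w , s') →
         Step t (x ++ [ i ]) x w

data Walk (t : Tree) : List Pos → ℚ → Set where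
  single : ∀ {x} → Vertex t x → Walk t [ x ] 0ℚ
  cons   : ∀ {x y rest w L} → Step t x y w → Walk t (y ∷ rest) L →
           Walk t (x ∷ y ∷ rest) (w + L)

PositiveWeights : Tree → Set
PositiveWeights t = ∀ x y w → Step t x y w → 0ℚ < w

sumℚ : List ℚ → ℚ
sumℚ = foldr _+_ 0ℚ

-- Exploration strategies (the tree is a subtree T' whose root is the
-- root of the data structure; β is its budget)

IsRoute : Tree → List Pos → ℚ → Set
IsRoute t ws L = Walk t ws L × head ws ≡ just [] × last ws ≡ just []

Strategy : Set
Strategy = List (List Pos × ℚ)

cost : Strategy → ℚ
cost s = sumℚ (map proj₂ s)

IsExploration : ℚ → Tree → Strategy → Set
IsExploration β t s =
  All (λ r → IsRoute t (proj₁ r) (proj₂ r) × proj₂ r ≤ β) s ×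
  (∀ x → Vertex t x → Any (λ r → x ∈ proj₁ r) s)

IsOptCost : ℚ → Tree → ℚ → Set
IsOptCost β t c =
  Σ Strategy (λ s → IsExploration β t s × cost s ≡ c) ×
  (∀ s → IsExploration β t s → c ≤ cost s)

-- DFS traversal (v_0, …, v_l) of a tree from its root (Euler tour
-- following the order of the children).

mutual
  dfs : Tree → List Pos
  dfs (node cs) = [] ∷ dfsL 0 cs

  dfsL : ℕ → List (ℚ × Tree) → List Pos
  dfsL i []             = []
  dfsL i ((_ , t) ∷ cs) = map (i ∷_) (dfs t) ++ ([] ∷ dfsL (suc i) cs)

module ADFS (t : Tree) (β : ℚ) where

  vs : List Pos
  vs = dfs t

  l : ℕ
  l = length vs ∸ 1

  at : ℕ → Pos
  at p = go vs p
    where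
    go : List Pos → ℕ → Pos
    go []       _       = []
    go (x ∷ _)  zero    = x
    go (_ ∷ xs) (suc n) = go xs n

  slice : ℕ → ℕ → List Pos
  slice a p = take (suc p ∸ a) (drop a vs)

  Largest : (ℕ → Set) → ℕ → Set
  Largest P j = j ≤ℕ l × P j × (∀ p → j <ℕ p → p ≤ℕ l → ¬ P p)

  Cond₁ : ℚ → ℕ → Set
  Cond₁ B′ p = Σ ℚ (λ L → Walk t (slice 0 p) L × L + depth t (at p) ≤ B′)

  Cond : ℕ → ℕ → Set
  Cond prev p = prev ≤ℕ p ×
    Σ ℚ (λ L → Walk t (slice prev p) L × depth t (at prev) + L + depth t (at p) ≤ β)

  -- Chain prev c : starting from index prev = j_{i-1}, the remaining
  -- routes R_i, R_{i+1}, … have total length c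
  data Chain : ℕ → ℚ → Set where
    stop : ∀ {prev} → prev ≡ l → Chain prev 0ℚ
    next : ∀ {prev j L c} → prev ≢ l → Largest (Cond prev) j →
           Walk t (slice prev j) L → Chain j c →
           Chain prev (depth t (at prev) + L + depth t (at j) + c)

  CostB′ : ℚ → ℚ → Set
  CostB′ B′ c = Σ ℕ (λ j → Σ ℚ (λ L → Σ ℚ (λ c′ →
    Largest (Cond₁ B′) j × Walk t (slice 0 j) L × Chain j c′ ×
    c ≡ L + depth t (at j) + c′)))

IsADFSCost : ℚ → Tree → ℚ → Set
IsADFSCost β t c =
  Σ ℚ (λ B′ → 0ℚ ≤ B′ × B′ ≤ β × ADFS.CostB′ t β B′ c) ×
  (∀ B′ c′ → 0ℚ ≤ B′ → B′ ≤ β → ADFS.CostB′ t β B′ c′ → c′ ≤ c)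

potential : ℚ → Tree → Pos → ℚ
potential B T v = ½ * B - depth T v

budget : ℚ → Tree → Pos → ℚ
budget B T v = potential B T v + potential B T v

-- T_e for the i-th downward edge e = (w, t) of a vertex: the single edge
-- tree rooted at that vertex
edgeTree : ℚ × Tree → Tree
edgeTree e = node [ e ]

{-# OPTIONS --safe #-}
module Submission where

-- A route visiting a set of vertices is at least twice as long as the subtree
-- spanned by them together with the root (a "pruning"), and the depth-first tour of a pruning
-- has exactly that length; so optimal explorations correspond to optimal families of prunings,
-- which exist because there are finitely many prunings. A pruning of T_v is a pair of prunings
-- of T_{e₁} and of the subtree formed by the other edges, with additive tour lengths, so the
-- optimum splits off the first edge, and induction on the number of edges gives the sum.
--
-- ADFS sees T only through the depths D p of the DFS vertices v_p and the lengths
-- len a p of the DFS walk between them. The DFS of T_v is the DFS of T_{e₁} followed by that of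
-- the other edges, glued at the root where D vanishes. Hence a run of ADFS_{B′} on T_v is a run
-- of ADFS_{B′} on T_{e₁} followed by a run of ADFS_r on the rest, r being the budget left when
-- the route crossing the root passes it; both budgets lie in [0, β], so the two runs cost at most
-- cost(ADFS(T_{e₁})) and cost(ADFS) of the rest.

open import Defs
open import Data.Rational using (ℚ; 0ℚ; 1ℚ; ½; _+_; _-_; -_; _*_; _≤_; _<_; _≤?_)
import Data.Rational.Properties as ℚ
open import Data.Nat using (ℕ; zero; suc; z≤n; s≤s; _∸_)
  renaming (_+_ to _+ℕ_; _≤_ to _≤ℕ_; _<_ to _<ℕ_)
import Data.Nat.Properties as ℕ
open import Data.List
  using (List; []; _∷_; _++_; [_]; map; take; drop; length; last; filter; deduplicate; upTo; cartesianProduct)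
import Data.List.Properties as List
open import Data.List.Membership.Propositional using (_∈_; find; lose)
open import Data.List.Membership.Propositional.Properties
  using (∈-map⁺; ∈-map⁻; ∈-++⁺ˡ; ∈-++⁺ʳ; ∈-++⁻; ∈-∃++; ∈-filter⁺; ∈-filter⁻;
         ∈-deduplicate⁺; ∈-cartesianProduct⁺; ∈-upTo⁺; ∈-upTo⁻)
import Data.List.Membership.DecPropositional as DecMembership
open import Data.List.Relation.Binary.Subset.Propositional using (_⊆_)
open import Data.List.Relation.Binary.Pointwise using (Pointwise; []; _∷_)
open import Data.List.Relation.Unary.All as All using (All; []; _∷_)
import Data.List.Relation.Unary.All.Properties as Allₚ
open import Data.List.Relation.Unary.Any as Any using (Any; here; there)
import Data.List.Relation.Unary.Any.Properties as Anyₚ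
open import Data.List.Relation.Unary.AllPairs using (_∷_)
open import Data.List.Relation.Unary.Unique.Propositional using (Unique)
import Data.List.Relation.Unary.Unique.Propositional.Properties as Unique
open import Data.List.Relation.Unary.Unique.DecPropositional.Properties using (deduplicate-!)
import Data.List.Extrema
open import Data.Maybe using (Maybe; just; nothing)
import Data.Maybe.Properties as Maybe
open import Data.Product using (Σ; ∃; ∃₂; _×_; _,_; proj₁; proj₂)
import Data.Product.Properties as Product
open import Data.Sum using (_⊎_; inj₁; inj₂)
open import Data.Unit using (⊤; tt)
open import Data.Empty using (⊥; ⊥-elim)
open import Function using (id)
open import Relation.Nullary using (¬_; Dec; yes; no)
open import Relation.Nullary.Decidable using (map′; _×-dec_)
open import Relation.Unary using (Decidable)
open import Relation.Binary.Bundles using (DecTotalOrder)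
open import Relation.Binary.Definitions using (DecidableEquality; tri<; tri≈; tri>)
open import Relation.Binary.PropositionalEquality
  using (_≡_; _≢_; refl; sym; trans; cong; cong₂; subst; subst₂; module ≡-Reasoning)
open import Data.Rational.Solver using (module +-*-Solver)
open +-*-Solver using (solve; _:+_; _:-_; _:=_)


-- Rational arithmetic and lists

p+q-p≡q : ∀ p q → p + q - p ≡ q
p+q-p≡q = solve 2 (λ p q → p :+ q :- p := q) refl

p-q+q≡p : ∀ p q → p - q + q ≡ p
p-q+q≡p = solve 2 (λ p q → p :- q :+ q := p) refl

p+[q+r]≡q+[p+r] : ∀ p q r → p + (q + r) ≡ q + (p + r)
p+[q+r]≡q+[p+r] = solve 3 (λ p q r → p :+ (q :+ r) := q :+ (p :+ r)) refl

p+q+r+s≡p+[q+r+s] : ∀ p q r s → p + q + r + s ≡ p + (q + r + s)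
p+q+r+s≡p+[q+r+s] = solve 4 (λ p q r s → p :+ q :+ r :+ s := p :+ (q :+ r :+ s)) refl

+-interchange : ∀ p q r s → (p + q) + (r + s) ≡ (p + r) + (q + s)
+-interchange = solve 4 (λ p q r s → (p :+ q) :+ (r :+ s) := (p :+ r) :+ (q :+ s)) refl

p≤p+q : ∀ {p q} → 0ℚ ≤ q → p ≤ p + q
p≤p+q {p} {q} 0≤q = subst (_≤ p + q) (ℚ.+-identityʳ p) (ℚ.+-monoʳ-≤ p 0≤q)

p≤q+p : ∀ {p q} → 0ℚ ≤ q → p ≤ q + p
p≤q+p {p} {q} 0≤q = subst (p ≤_) (ℚ.+-comm p q) (p≤p+q 0≤q)

p+q≤r⇒q≤r-p : ∀ {p q r} → p + q ≤ r → q ≤ r - p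
p+q≤r⇒q≤r-p {p} {q} {r} p+q≤r = subst (_≤ r - p) (p+q-p≡q p q) (ℚ.+-monoˡ-≤ (- p) p+q≤r)

q≤r-p⇒p+q≤r : ∀ {p q r} → q ≤ r - p → p + q ≤ r
q≤r-p⇒p+q≤r {p} {q} {r} q≤r-p = subst₂ _≤_ (ℚ.+-comm q p) (p-q+q≡p r p) (ℚ.+-monoˡ-≤ p q≤r-p)

p-q≤p : ∀ {p q} → 0ℚ ≤ q → p - q ≤ p
p-q≤p {p} {q} 0≤q = subst₂ _≤_ (ℚ.+-identityʳ (p - q)) (p-q+q≡p p q) (ℚ.+-monoʳ-≤ (p - q) 0≤q)

sumℚ-++ : ∀ xs ys → sumℚ (xs ++ ys) ≡ sumℚ xs + sumℚ ys
sumℚ-++ []       ys = sym (ℚ.+-identityˡ _)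
sumℚ-++ (x ∷ xs) ys = trans (cong (x +_) (sumℚ-++ xs ys)) (sym (ℚ.+-assoc x _ _))

sumℚ-nonNeg : ∀ {xs} → All (0ℚ ≤_) xs → 0ℚ ≤ sumℚ xs
sumℚ-nonNeg []         = ℚ.≤-refl
sumℚ-nonNeg (0≤x ∷ xs) = ℚ.+-mono-≤ 0≤x (sumℚ-nonNeg xs)

sum-map-nonNeg : ∀ {A : Set} (f : A → ℚ) xs → (∀ x → 0ℚ ≤ f x) → 0ℚ ≤ sumℚ (map f xs)
sum-map-nonNeg f xs 0≤f = sumℚ-nonNeg (Allₚ.map⁺ (All.universal 0≤f xs))

sum-map-++ : ∀ {A : Set} (f : A → ℚ) xs ys →
             sumℚ (map f (xs ++ ys)) ≡ sumℚ (map f xs) + sumℚ (map f ys)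
sum-map-++ f xs ys = trans (cong sumℚ (List.map-++ f xs ys)) (sumℚ-++ (map f xs) (map f ys))

sum-map-mono-⊆ : ∀ {A : Set} (f : A → ℚ) {xs ys} → (∀ x → 0ℚ ≤ f x) → Unique xs → xs ⊆ ys →
                 sumℚ (map f xs) ≤ sumℚ (map f ys)
sum-map-mono-⊆ f {[]}     {ys} 0≤f _            _    = sum-map-nonNeg f ys 0≤f
sum-map-mono-⊆ f {x ∷ xs} {ys} 0≤f (x∉xs ∷ uxs) x∷xs⊆ys
  with as , bs , refl ← ∈-∃++ (x∷xs⊆ys (here refl)) = begin
    f x + sumℚ (map f xs)
      ≤⟨ ℚ.+-monoʳ-≤ (f x) (sum-map-mono-⊆ f 0≤f uxs xs⊆as++bs) ⟩
    f x + sumℚ (map f (as ++ bs))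
      ≡⟨ cong (f x +_) (sum-map-++ f as bs) ⟩
    f x + (sumℚ (map f as) + sumℚ (map f bs))
      ≡⟨ p+[q+r]≡q+[p+r] (f x) (sumℚ (map f as)) (sumℚ (map f bs)) ⟩
    sumℚ (map f as) + (f x + sumℚ (map f bs))
      ≡⟨ sym (sum-map-++ f as (x ∷ bs)) ⟩
    sumℚ (map f (as ++ x ∷ bs)) ∎
  where
  open ℚ.≤-Reasoning
  xs⊆as++bs : xs ⊆ as ++ bs
  xs⊆as++bs {z} z∈xs with ∈-++⁻ as (x∷xs⊆ys (there z∈xs))
  ... | inj₁ z∈as         = ∈-++⁺ˡ z∈as
  ... | inj₂ (here refl)  = ⊥-elim (All.lookup x∉xs z∈xs refl)
  ... | inj₂ (there z∈bs) = ∈-++⁺ʳ as z∈bs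

sublists : ∀ {A : Set} → List A → List (List A)
sublists []       = [ [] ]
sublists (x ∷ xs) = map (x ∷_) (sublists xs) ++ sublists xs

filter∈sublists : ∀ {A : Set} {P : A → Set} (P? : ∀ x → Dec (P x)) xs → filter P? xs ∈ sublists xs
filter∈sublists P? []       = here refl
filter∈sublists P? (x ∷ xs) with P? x
... | yes _ = ∈-++⁺ˡ (∈-map⁺ (x ∷_) (filter∈sublists P? xs))
... | no  _ = ∈-++⁺ʳ (map (x ∷_) (sublists xs)) (filter∈sublists P? xs)

drop-suc : ∀ {A : Set} (xs : List A) i {x ys} → drop i xs ≡ x ∷ ys → drop (suc i) xs ≡ ys
drop-suc (x ∷ xs) zero    refl = refl
drop-suc (x ∷ xs) (suc i) eq   = drop-suc xs i eq

lookupOr : ∀ {A : Set} → A → List A → ℕ → A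
lookupOr d []       _       = d
lookupOr d (x ∷ _)  zero    = x
lookupOr d (_ ∷ xs) (suc n) = lookupOr d xs n

lookupOr-unique : ∀ {A : Set} {d : A} {F : List A → ℕ → A} →
                  (∀ n → F [] n ≡ d) → (∀ x xs → F (x ∷ xs) zero ≡ x) →
                  (∀ x xs n → F (x ∷ xs) (suc n) ≡ F xs n) → ∀ xs n → F xs n ≡ lookupOr d xs n
lookupOr-unique F[] F0 Fsuc []       n       = F[] n
lookupOr-unique F[] F0 Fsuc (x ∷ xs) zero    = F0 x xs
lookupOr-unique F[] F0 Fsuc (x ∷ xs) (suc n) = trans (Fsuc x xs n) (lookupOr-unique F[] F0 Fsuc xs n)

lookupOr-all : ∀ {A : Set} {P : A → Set} {d} xs p → All P xs → P d → P (lookupOr d xs p)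
lookupOr-all []       p       []         Pd = Pd
lookupOr-all (x ∷ xs) zero    (Px ∷ _)   Pd = Px
lookupOr-all (x ∷ xs) (suc p) (_ ∷ Pxs)  Pd = lookupOr-all xs p Pxs Pd

lookupOr-last : ∀ {A : Set} {d : A} xs {y} → last xs ≡ just y → lookupOr d xs (length xs ∸ 1) ≡ y
lookupOr-last (x ∷ [])      refl = refl
lookupOr-last (x ∷ x′ ∷ xs) eq   = lookupOr-last (x′ ∷ xs) eq

take-1-drop : ∀ {A : Set} {d : A} xs p → p <ℕ length xs → take 1 (drop p xs) ≡ [ lookupOr d xs p ]
take-1-drop (x ∷ xs) zero    _        = refl
take-1-drop (x ∷ xs) (suc p) (s≤s p<) = take-1-drop xs p p<

module _ {A : Set} where

  lookupOr-++ˡ : ∀ {d : A} xs ys p → p <ℕ length xs → lookupOr d (xs ++ ys) p ≡ lookupOr d xs p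
  lookupOr-++ˡ (x ∷ xs) ys zero    _        = refl
  lookupOr-++ˡ (x ∷ xs) ys (suc p) (s≤s p<) = lookupOr-++ˡ xs ys p p<

  lookupOr-++ʳ : ∀ {d : A} xs ys q → lookupOr d (xs ++ ys) (length xs +ℕ q) ≡ lookupOr d ys q
  lookupOr-++ʳ []       ys q = refl
  lookupOr-++ʳ (x ∷ xs) ys q = lookupOr-++ʳ xs ys q

  lookupOr-map : ∀ {d : A} (f : A → A) xs p → f d ≡ d → lookupOr d (map f xs) p ≡ f (lookupOr d xs p)
  lookupOr-map f []       p       fd≡d = sym fd≡d
  lookupOr-map f (x ∷ xs) zero    _    = refl
  lookupOr-map f (x ∷ xs) (suc p) fd≡d = lookupOr-map f xs p fd≡d

  drop-++ˡ : ∀ a (xs ys : List A) → a ≤ℕ length xs → drop a (xs ++ ys) ≡ drop a xs ++ ys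
  drop-++ˡ zero    xs       ys _        = refl
  drop-++ˡ (suc a) (x ∷ xs) ys (s≤s a≤) = drop-++ˡ a xs ys a≤

  drop-++ʳ : ∀ (xs ys : List A) a → drop (length xs +ℕ a) (xs ++ ys) ≡ drop a ys
  drop-++ʳ []       ys a = refl
  drop-++ʳ (x ∷ xs) ys a = drop-++ʳ xs ys a

  take-++ˡ : ∀ n (xs ys : List A) → n ≤ℕ length xs → take n (xs ++ ys) ≡ take n xs
  take-++ˡ zero    xs       ys _        = refl
  take-++ˡ (suc n) (x ∷ xs) ys (s≤s n≤) = cong (x ∷_) (take-++ˡ n xs ys n≤)

  take-++ʳ : ∀ (xs ys : List A) q → take (length xs +ℕ q) (xs ++ ys) ≡ xs ++ take q ys
  take-++ʳ []       ys q = refl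
  take-++ʳ (x ∷ xs) ys q = cong (x ∷_) (take-++ʳ xs ys q)


-- Steps, walks and edge weights

lookupChild : List (ℚ × Tree) → ℕ → Maybe (ℚ × Tree)
lookupChild []       _       = nothing
lookupChild (c ∷ cs) zero    = just c
lookupChild (_ ∷ cs) (suc i) = lookupChild cs i

childAt-node : ∀ cs i → childAt (node cs) i ≡ lookupChild cs i
childAt-node []       i       = refl
childAt-node (c ∷ cs) zero    = refl
childAt-node (c ∷ cs) (suc i) = childAt-node cs i

lookupChild-drop : ∀ cs₀ i {c cs} → drop i cs₀ ≡ c ∷ cs → lookupChild cs₀ i ≡ just c
lookupChild-drop (c ∷ cs₀) zero    refl = refl
lookupChild-drop (c ∷ cs₀) (suc i) eq   = lookupChild-drop cs₀ i eq

subL-lookup : ∀ cs i {w t} x → lookupChild cs i ≡ just (w , t) → subL cs i x ≡ sub t x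
subL-lookup (c ∷ cs) zero    x refl = refl
subL-lookup (c ∷ cs) (suc i) x eq   = subL-lookup cs i x eq

subL-lookup⁻ : ∀ cs i x {s} → subL cs i x ≡ just s →
               ∃ λ w → ∃ λ t → lookupChild cs i ≡ just (w , t) × sub t x ≡ just s
subL-lookup⁻ ((w , t) ∷ cs) zero    x eq = w , t , refl , eq
subL-lookup⁻ (c ∷ cs)       (suc i) x eq = subL-lookup⁻ cs i x eq

depthL-lookup : ∀ cs i {w t} x → lookupChild cs i ≡ just (w , t) → depthL cs i x ≡ w + depth t x
depthL-lookup (c ∷ cs) zero    x refl = refl
depthL-lookup (c ∷ cs) (suc i) x eq   = depthL-lookup cs i x eq

mutual
  sub-++ : ∀ t v {s} x → sub t v ≡ just s → sub t (v ++ x) ≡ sub s x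
  sub-++ t         []      x refl = refl
  sub-++ (node cs) (i ∷ v) x eq   = subL-++ cs i v x eq

  subL-++ : ∀ cs i v {s} x → subL cs i v ≡ just s → subL cs i (v ++ x) ≡ sub s x
  subL-++ ((_ , t) ∷ cs) zero    v x eq = sub-++ t v x eq
  subL-++ (_ ∷ cs)       (suc i) v x eq = subL-++ cs i v x eq

mutual
  depth-++ : ∀ t v {s} x → sub t v ≡ just s → depth t (v ++ x) ≡ depth t v + depth s x
  depth-++ t         []      x refl = sym (ℚ.+-identityˡ _)
  depth-++ (node cs) (i ∷ v) x eq   = depthL-++ cs i v x eq

  depthL-++ : ∀ cs i v {s} x → subL cs i v ≡ just s →
              depthL cs i (v ++ x) ≡ depthL cs i v + depth s x
  depthL-++ ((w , t) ∷ cs) zero    v x eq =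
    trans (cong (w +_) (depth-++ t v x eq)) (sym (ℚ.+-assoc w _ _))
  depthL-++ (_ ∷ cs)       (suc i) v x eq = depthL-++ cs i v x eq

sub-snoc : ∀ t x {s i w s′} → sub t x ≡ just s → childAt s i ≡ just (w , s′) →
           sub t (x ++ [ i ]) ≡ just s′
sub-snoc t x {node cs} {i} x∈t i∈s =
  trans (sub-++ t x [ i ] x∈t) (subL-lookup cs i [] (trans (sym (childAt-node cs i)) i∈s))

depth-snoc : ∀ t x {s i w s′} → sub t x ≡ just s → childAt s i ≡ just (w , s′) →
             depth t (x ++ [ i ]) ≡ depth t x + w
depth-snoc t x {node cs} {i} {w} x∈t i∈s =
  trans (depth-++ t x [ i ] x∈t)
    (cong (depth t x +_)
      (trans (depthL-lookup cs i [] (trans (sym (childAt-node cs i)) i∈s)) (ℚ.+-identityʳ w)))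

step-source : ∀ {t x y w} → Step t x y w → Vertex t x
step-source             (down {s = s} x∈t _)    = s , x∈t
step-source {t} {y = y} (up {s' = s′} x∈t i∈s) = s′ , sub-snoc t y x∈t i∈s

step-depth : ∀ {t x y w} → Step t x y w →
             depth t y ≡ depth t x + w ⊎ depth t x ≡ depth t y + w
step-depth {t} {x}     (down x∈t i∈s) = inj₁ (depth-snoc t x x∈t i∈s)
step-depth {t} {y = y} (up x∈t i∈s)   = inj₂ (depth-snoc t y x∈t i∈s)

snoc-cycle : ∀ (x y : Pos) i j → x ≡ y ++ [ j ] → x ++ [ i ] ≢ y
snoc-cycle _ y i j refl eq = ℕ.m+1+n≢m (length y) {1} (sym (begin
  length y                        ≡⟨ cong length (sym eq) ⟩
  length ((y ++ [ j ]) ++ [ i ])  ≡⟨ List.length-++ (y ++ [ j ]) ⟩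
  length (y ++ [ j ]) +ℕ 1        ≡⟨ cong (_+ℕ 1) (List.length-++ y) ⟩
  length y +ℕ 1 +ℕ 1              ≡⟨ ℕ.+-assoc (length y) 1 1 ⟩
  length y +ℕ 2                   ∎))
  where open ≡-Reasoning

private
  step-weight-unique′ : ∀ {t x y w x′ y′ w′} → Step t x y w → Step t x′ y′ w′ →
                        x ≡ x′ → y ≡ y′ → w ≡ w′
  step-weight-unique′ (down {x = x} x∈t i∈s) (down x∈t′ i∈s′) refl eq
    with refl ← List.∷ʳ-injectiveʳ x x eq
    with refl ← trans (sym x∈t) x∈t′
    = cong proj₁ (Maybe.just-injective (trans (sym i∈s) i∈s′))
  step-weight-unique′ (up {x = x} x∈t i∈s) (up x∈t′ i∈s′) eq refl
    with refl ← List.∷ʳ-injectiveʳ x x eq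
    with refl ← trans (sym x∈t) x∈t′
    = cong proj₁ (Maybe.just-injective (trans (sym i∈s) i∈s′))
  step-weight-unique′ (down {x = x} {i = i} _ _) (up {x = y} {i = j} _ _) eq eq′ =
    ⊥-elim (snoc-cycle x y i j eq eq′)
  step-weight-unique′ (up {x = x} {i = i} _ _) (down {x = y} {i = j} _ _) eq eq′ =
    ⊥-elim (snoc-cycle x y i j eq′ eq)

step-weight-unique : ∀ {t x y w w′} → Step t x y w → Step t x y w′ → w ≡ w′
step-weight-unique st st′ = step-weight-unique′ st st′ refl refl

walk-length-unique : ∀ {t vs L L′} → Walk t vs L → Walk t vs L′ → L ≡ L′
walk-length-unique (single _)  (single _)    = refl
walk-length-unique (cons st w) (cons st′ w′) =
  cong₂ _+_ (step-weight-unique st st′) (walk-length-unique w w′)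

data Path (t : Tree) : Pos → Pos → List Pos → List ℚ → Set where
  end : ∀ {x} → Vertex t x → Path t x x [ x ] []
  _◅_ : ∀ {x y z vs ws w} → Step t x y w → Path t y z vs ws → Path t x z (x ∷ vs) (w ∷ ws)

infixr 5 _◅_

module _ {t : Tree} where

  path-head : ∀ {x y vs ws} → Path t x y vs ws → ∃ λ vs′ → vs ≡ x ∷ vs′
  path-head (end _) = _ , refl
  path-head (_ ◅ _) = _ , refl

  path⇒walk : ∀ {x y vs ws} → Path t x y vs ws → Walk t vs (sumℚ ws)
  path⇒walk (end v) = single v
  path⇒walk (st ◅ p) with _ , refl ← path-head p = cons st (path⇒walk p)

  walk⇒path : ∀ {x vs L} → Walk t (x ∷ vs) L →
              ∃₂ λ y ws → Path t x y (x ∷ vs) ws × L ≡ sumℚ ws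
  walk⇒path (single v) = _ , [] , end v , refl
  walk⇒path (cons st w) with _ , ws , p , refl ← walk⇒path w = _ , _ ∷ ws , st ◅ p , refl

  path-last : ∀ {x y vs ws} → Path t x y vs ws → last vs ≡ just y
  path-last (end _) = refl
  path-last (_ ◅ p) with _ , refl ← path-head p = path-last p

  path-length : ∀ {x y vs ws} → Path t x y vs ws → length vs ≡ suc (length ws)
  path-length (end _) = refl
  path-length (_ ◅ p) = cong suc (path-length p)

  path-++ : ∀ {x y y′ z vs vs′ ws ws′ w} → Path t x y vs ws → Step t y y′ w → Path t y′ z vs′ ws′ →
            Path t x z (vs ++ vs′) (ws ++ w ∷ ws′)
  path-++ (end _)  st q = st ◅ q
  path-++ (s ◅ p)  st q = s ◅ path-++ p st q

  path-vertices : ∀ {x y vs ws} → Path t x y vs ws → All (Vertex t) vs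
  path-vertices (end v)  = v ∷ []
  path-vertices (st ◅ p) = step-source st ∷ path-vertices p

  path-step : ∀ {x y vs ws} → Path t x y vs ws → ∀ p → p <ℕ length ws →
              Step t (lookupOr [] vs p) (lookupOr [] vs (suc p)) (lookupOr 0ℚ ws p)
  path-step (st ◅ q) zero    _ with _ , refl ← path-head q = st
  path-step (st ◅ q) (suc p) (s≤s p<) = path-step q p p<

  path-drop : ∀ {x y vs ws} a → a ≤ℕ length ws → Path t x y vs ws →
              ∃ λ x′ → Path t x′ y (drop a vs) (drop a ws)
  path-drop zero    _       q        = _ , q
  path-drop (suc a) (s≤s a≤) (_ ◅ q) = path-drop a a≤ q

  path-take : ∀ {x y vs ws} n → n ≤ℕ length ws → Path t x y vs ws →
              ∃ λ y′ → Path t x y′ (take (suc n) vs) (take n ws)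
  path-take zero    _        (end v)  = _ , end v
  path-take zero    _        (st ◅ _) = _ , end (step-source st)
  path-take (suc n) (s≤s n≤) (st ◅ q) with _ , refl ← path-head q = _ , st ◅ proj₂ (path-take n n≤ q)

module _ (cs : List (ℚ × Tree)) (i : ℕ) {w : ℚ} {t : Tree} (i∈cs : lookupChild cs i ≡ just (w , t)) where

  lift-step : ∀ {x y w′} → Step t x y w′ → Step (node cs) (i ∷ x) (i ∷ y) w′
  lift-step (down x∈t j∈s) = down (trans (subL-lookup cs i _ i∈cs) x∈t) j∈s
  lift-step (up x∈t j∈s)   = up (trans (subL-lookup cs i _ i∈cs) x∈t) j∈s

  lift-path : ∀ {x y vs ws} → Path t x y vs ws → Path (node cs) (i ∷ x) (i ∷ y) (map (i ∷_) vs) ws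
  lift-path (end (s , x∈t)) = end (s , trans (subL-lookup cs i _ i∈cs) x∈t)
  lift-path (st ◅ p)        = lift-step st ◅ lift-path p

  step-root-child : Step (node cs) [] [ i ] w
  step-root-child = down {x = []} refl (trans (childAt-node cs i) i∈cs)

  step-child-root : Step (node cs) [ i ] [] w
  step-child-root = up {x = []} refl (trans (childAt-node cs i) i∈cs)

mutual
  NonNegWeights : Tree → Set
  NonNegWeights (node cs) = NonNegWeightsL cs

  NonNegWeightsL : List (ℚ × Tree) → Set
  NonNegWeightsL []             = ⊤
  NonNegWeightsL ((w , t) ∷ cs) = 0ℚ ≤ w × NonNegWeights t × NonNegWeightsL cs

nonNegWeights-lookup : ∀ cs i {w t} → NonNegWeightsL cs → lookupChild cs i ≡ just (w , t) →
                       0ℚ ≤ w × NonNegWeights t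
nonNegWeights-lookup ((w , t) ∷ cs) zero    (0≤w , nn , _) refl = 0≤w , nn
nonNegWeights-lookup (c ∷ cs)       (suc i) (_ , _ , nn)  eq   = nonNegWeights-lookup cs i nn eq

Explorable : ℚ → Tree → Set
Explorable β t = ∀ x → Vertex t x → depth t x + depth t x ≤ β

mutual
  nonNegWeights-sub : ∀ T v {s} → PositiveWeights T → sub T v ≡ just s → NonNegWeights s
  nonNegWeights-sub T v {node cs} pos v∈T = nonNegWeightsL-sub T v pos v∈T 0 cs refl

  nonNegWeightsL-sub : ∀ T v {cs₀} → PositiveWeights T → sub T v ≡ just (node cs₀) →
                       ∀ i cs → drop i cs₀ ≡ cs → NonNegWeightsL cs
  nonNegWeightsL-sub T v pos v∈T i []             _ = tt
  nonNegWeightsL-sub T v {cs₀} pos v∈T i ((w , t) ∷ cs) eq =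
    ℚ.<⇒≤ (pos v (v ++ [ i ]) w (down v∈T i∈cs₀)) ,
    nonNegWeights-sub T (v ++ [ i ]) pos (sub-snoc T v v∈T i∈cs₀) ,
    nonNegWeightsL-sub T v pos v∈T (suc i) cs (drop-suc cs₀ i eq)
    where
    i∈cs₀ = trans (childAt-node cs₀ i) (lookupChild-drop cs₀ i eq)

explorable-sub : ∀ T B v {s} → (∀ x → Vertex T x → depth T x ≤ ½ * B) → sub T v ≡ just s →
                 Explorable (budget B T v) s
explorable-sub T B v bounded v∈T x (s′ , x∈s) = ℚ.+-mono-≤ depth≤ depth≤
  where
  depth≤ : depth _ x ≤ potential B T v
  depth≤ = p+q≤r⇒q≤r-p (subst (_≤ ½ * B) (depth-++ T v x v∈T)
                                 (bounded (v ++ x) (s′ , trans (sub-++ T v x v∈T) x∈s)))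

module _ {w : ℚ} {t : Tree} {es : List (ℚ × Tree)} where

  nonNegWeights-head : NonNegWeights (node ((w , t) ∷ es)) → NonNegWeights (edgeTree (w , t))
  nonNegWeights-head (0≤w , nt , _) = 0≤w , nt , tt

  nonNegWeights-tail : NonNegWeights (node ((w , t) ∷ es)) → NonNegWeights (node es)
  nonNegWeights-tail (_ , _ , nn) = nn

  explorable-head : ∀ {β} → Explorable β (node ((w , t) ∷ es)) → Explorable β (edgeTree (w , t))
  explorable-head explorable []          _ = explorable [] (_ , refl)
  explorable-head explorable (zero ∷ y)  v = explorable (zero ∷ y) v
  explorable-head explorable (suc _ ∷ _) (_ , ())

  explorable-tail : ∀ {β} → Explorable β (node ((w , t) ∷ es)) → Explorable β (node es)
  explorable-tail explorable []      _ = explorable [] (_ , refl)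
  explorable-tail explorable (k ∷ y) v = explorable (suc k ∷ y) v

mutual
  depth-nonNeg : ∀ t x → NonNegWeights t → 0ℚ ≤ depth t x
  depth-nonNeg t         []      _  = ℚ.≤-refl
  depth-nonNeg (node cs) (i ∷ x) nn = depthL-nonNeg cs i x nn

  depthL-nonNeg : ∀ cs i x → NonNegWeightsL cs → 0ℚ ≤ depthL cs i x
  depthL-nonNeg []             i       x _               = ℚ.≤-refl
  depthL-nonNeg ((w , t) ∷ cs) zero    x (0≤w , nt , _)  = ℚ.+-mono-≤ 0≤w (depth-nonNeg t x nt)
  depthL-nonNeg (_ ∷ cs)       (suc i) x (_ , _ , nn)    = depthL-nonNeg cs i x nn


-- Prunings and their tours

-- A pruning of a tree (a subtree containing its root) keeps or drops each child, recursively.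
mutual
  Pruning : Tree → Set
  Pruning (node cs) = PruningL cs

  PruningL : List (ℚ × Tree) → Set
  PruningL []             = ⊤
  PruningL ((_ , t) ∷ cs) = Maybe (Pruning t) × PruningL cs

mutual
  weight : (t : Tree) → Pruning t → ℚ
  weight (node cs) P = weightL cs P

  weightL : (cs : List (ℚ × Tree)) → PruningL cs → ℚ
  weightL []             _       = 0ℚ
  weightL ((w , t) ∷ cs) (m , P) = weightM w t m + weightL cs P

  weightM : ℚ → (t : Tree) → Maybe (Pruning t) → ℚ
  weightM w t nothing  = 0ℚ
  weightM w t (just Q) = w + weight t Q

tourLength : (t : Tree) → Pruning t → ℚ
tourLength t P = weight t P + weight t P

mutual
  covers : (t : Tree) → Pruning t → Pos → Set
  covers t         P []      = ⊤
  covers (node cs) P (i ∷ x) = coversL cs P i x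

  coversL : (cs : List (ℚ × Tree)) → PruningL cs → ℕ → Pos → Set
  coversL []             _       _       _ = ⊥
  coversL ((w , t) ∷ cs) (m , P) zero    x = coversM t m x
  coversL (_ ∷ cs)       (m , P) (suc i) x = coversL cs P i x

  coversM : (t : Tree) → Maybe (Pruning t) → Pos → Set
  coversM t nothing  x = ⊥
  coversM t (just Q) x = covers t Q x

mutual
  whole : (t : Tree) → Pruning t
  whole (node cs) = wholeL cs

  wholeL : (cs : List (ℚ × Tree)) → PruningL cs
  wholeL []             = tt
  wholeL ((w , t) ∷ cs) = just (whole t) , wholeL cs

rootOnlyL : (cs : List (ℚ × Tree)) → PruningL cs
rootOnlyL []       = tt
rootOnlyL (_ ∷ cs) = nothing , rootOnlyL cs

weight-rootOnlyL : ∀ cs → weightL cs (rootOnlyL cs) ≡ 0ℚ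
weight-rootOnlyL []       = refl
weight-rootOnlyL (c ∷ cs) = trans (ℚ.+-identityˡ _) (weight-rootOnlyL cs)

mutual
  tour : (t : Tree) → Pruning t → List Pos
  tour (node cs) P = [] ∷ tourL 0 cs P

  tourL : ℕ → (cs : List (ℚ × Tree)) → PruningL cs → List Pos
  tourL i []             _              = []
  tourL i ((w , t) ∷ cs) (nothing , P) = tourL (suc i) cs P
  tourL i ((w , t) ∷ cs) (just Q , P)  = map (i ∷_) (tour t Q) ++ ([] ∷ tourL (suc i) cs P)

mutual
  tourSteps : (t : Tree) → Pruning t → List ℚ
  tourSteps (node cs) P = tourStepsL cs P

  tourStepsL : (cs : List (ℚ × Tree)) → PruningL cs → List ℚ
  tourStepsL []             _              = []
  tourStepsL ((w , t) ∷ cs) (nothing , P) = tourStepsL cs P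
  tourStepsL ((w , t) ∷ cs) (just Q , P)  = w ∷ (tourSteps t Q ++ (w ∷ tourStepsL cs P))

mutual
  tour-path : ∀ t (P : Pruning t) → Path t [] [] (tour t P) (tourSteps t P)
  tour-path (node cs) P = tourL-path cs 0 cs refl P

  tourL-path : ∀ cs₀ i cs → drop i cs₀ ≡ cs → (P : PruningL cs) →
               Path (node cs₀) [] [] ([] ∷ tourL i cs P) (tourStepsL cs P)
  tourL-path cs₀ i []             eq P             = end (node cs₀ , refl)
  tourL-path cs₀ i ((w , t) ∷ cs) eq (nothing , P) = tourL-path cs₀ (suc i) cs (drop-suc cs₀ i eq) P
  tourL-path cs₀ i ((w , t) ∷ cs) eq (just Q , P)  =
    step-root-child cs₀ i i∈cs
      ◅ path-++ (lift-path cs₀ i i∈cs (tour-path t Q)) (step-child-root cs₀ i i∈cs)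
                (tourL-path cs₀ (suc i) cs (drop-suc cs₀ i eq) P)
    where i∈cs = lookupChild-drop cs₀ i eq

tour-route : ∀ t (P : Pruning t) → IsRoute t (tour t P) (sumℚ (tourSteps t P))
tour-route (node cs) P = path⇒walk (tour-path (node cs) P) , refl , path-last (tour-path (node cs) P)

mutual
  sum-tourSteps : ∀ t (P : Pruning t) → sumℚ (tourSteps t P) ≡ tourLength t P
  sum-tourSteps (node cs) P = sum-tourStepsL cs P

  sum-tourStepsL : ∀ cs (P : PruningL cs) → sumℚ (tourStepsL cs P) ≡ weightL cs P + weightL cs P
  sum-tourStepsL []             P             = refl
  sum-tourStepsL ((w , t) ∷ cs) (nothing , P) =
    trans (sum-tourStepsL cs P) (sym (cong₂ _+_ (ℚ.+-identityˡ (weightL cs P)) (ℚ.+-identityˡ (weightL cs P))))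
  sum-tourStepsL ((w , t) ∷ cs) (just Q , P)  =
    trans (cong (w +_) (trans (sumℚ-++ (tourSteps t Q) (w ∷ tourStepsL cs P))
                         (cong₂ (λ a b → a + (w + b)) (sum-tourSteps t Q) (sum-tourStepsL cs P))))
          (solve 3 (λ w a b → w :+ ((a :+ a) :+ (w :+ (b :+ b))) := ((w :+ a) :+ b) :+ ((w :+ a) :+ b))
                 refl w (weight t Q) (weightL cs P))

mutual
  covers⇒∈tour : ∀ t (P : Pruning t) x → covers t P x → x ∈ tour t P
  covers⇒∈tour (node cs) P []      _   = here refl
  covers⇒∈tour (node cs) P (k ∷ y) cov = there (coversL⇒∈tourL 0 cs P k y cov)

  coversL⇒∈tourL : ∀ i cs (P : PruningL cs) k y → coversL cs P k y → (i +ℕ k ∷ y) ∈ tourL i cs P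
  coversL⇒∈tourL i ((w , t) ∷ cs) (just Q , P) zero y cov =
    ∈-++⁺ˡ (subst (λ z → (z ∷ y) ∈ map (i ∷_) (tour t Q)) (sym (ℕ.+-identityʳ i))
                  (∈-map⁺ (i ∷_) (covers⇒∈tour t Q y cov)))
  coversL⇒∈tourL i ((w , t) ∷ cs) (nothing , P) (suc k) y cov =
    subst (λ z → (z ∷ y) ∈ tourL (suc i) cs P) (sym (ℕ.+-suc i k)) (coversL⇒∈tourL (suc i) cs P k y cov)
  coversL⇒∈tourL i ((w , t) ∷ cs) (just Q , P) (suc k) y cov =
    ∈-++⁺ʳ (map (i ∷_) (tour t Q)) (there
      (subst (λ z → (z ∷ y) ∈ tourL (suc i) cs P) (sym (ℕ.+-suc i k)) (coversL⇒∈tourL (suc i) cs P k y cov)))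

mutual
  join : (t : Tree) → Pruning t → Pruning t → Pruning t
  join (node cs) P Q = joinL cs P Q

  joinL : (cs : List (ℚ × Tree)) → PruningL cs → PruningL cs → PruningL cs
  joinL []             _       _         = tt
  joinL ((w , t) ∷ cs) (m , P) (m′ , P′) = joinM t m m′ , joinL cs P P′

  joinM : (t : Tree) → Maybe (Pruning t) → Maybe (Pruning t) → Maybe (Pruning t)
  joinM t nothing  m′        = m′
  joinM t (just Q) nothing   = just Q
  joinM t (just Q) (just Q′) = just (join t Q Q′)

mutual
  covers-joinˡ : ∀ t (P Q : Pruning t) x → covers t P x → covers t (join t P Q) x
  covers-joinˡ t         P Q []      _   = tt
  covers-joinˡ (node cs) P Q (i ∷ x) cov = coversL-joinˡ cs P Q i x cov

  coversL-joinˡ : ∀ cs (P Q : PruningL cs) i x → coversL cs P i x → coversL cs (joinL cs P Q) i x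
  coversL-joinˡ ((w , t) ∷ cs) (just R , P) (nothing , Q) zero    x cov = cov
  coversL-joinˡ ((w , t) ∷ cs) (just R , P) (just R′ , Q) zero    x cov = covers-joinˡ t R R′ x cov
  coversL-joinˡ (_ ∷ cs)       (_ , P)      (_ , Q)       (suc i) x cov = coversL-joinˡ cs P Q i x cov

mutual
  covers-joinʳ : ∀ t (P Q : Pruning t) x → covers t Q x → covers t (join t P Q) x
  covers-joinʳ t         P Q []      _   = tt
  covers-joinʳ (node cs) P Q (i ∷ x) cov = coversL-joinʳ cs P Q i x cov

  coversL-joinʳ : ∀ cs (P Q : PruningL cs) i x → coversL cs Q i x → coversL cs (joinL cs P Q) i x
  coversL-joinʳ ((w , t) ∷ cs) (nothing , P) (just R′ , Q) zero    x cov = cov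
  coversL-joinʳ ((w , t) ∷ cs) (just R , P)  (just R′ , Q) zero    x cov = covers-joinʳ t R R′ x cov
  coversL-joinʳ (_ ∷ cs)       (_ , P)       (_ , Q)       (suc i) x cov = coversL-joinʳ cs P Q i x cov

mutual
  covers-join⁻ : ∀ t (P Q : Pruning t) x → covers t (join t P Q) x → covers t P x ⊎ covers t Q x
  covers-join⁻ t         P Q []      _   = inj₁ tt
  covers-join⁻ (node cs) P Q (i ∷ x) cov = coversL-join⁻ cs P Q i x cov

  coversL-join⁻ : ∀ cs (P Q : PruningL cs) i x → coversL cs (joinL cs P Q) i x →
                  coversL cs P i x ⊎ coversL cs Q i x
  coversL-join⁻ ((w , t) ∷ cs) (nothing , P) (_ , Q)       zero    x cov = inj₂ cov
  coversL-join⁻ ((w , t) ∷ cs) (just R , P)  (nothing , Q) zero    x cov = inj₁ cov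
  coversL-join⁻ ((w , t) ∷ cs) (just R , P)  (just R′ , Q) zero    x cov = covers-join⁻ t R R′ x cov
  coversL-join⁻ (_ ∷ cs)       (_ , P)       (_ , Q)       (suc i) x cov = coversL-join⁻ cs P Q i x cov

mutual
  weight-nonNeg : ∀ t (P : Pruning t) → NonNegWeights t → 0ℚ ≤ weight t P
  weight-nonNeg (node cs) P nn = weightL-nonNeg cs P nn

  weightL-nonNeg : ∀ cs (P : PruningL cs) → NonNegWeightsL cs → 0ℚ ≤ weightL cs P
  weightL-nonNeg []             P             nn              = ℚ.≤-refl
  weightL-nonNeg ((w , t) ∷ cs) (nothing , P) (_ , _ , nn)    = ℚ.+-mono-≤ ℚ.≤-refl (weightL-nonNeg cs P nn)
  weightL-nonNeg ((w , t) ∷ cs) (just Q , P)  (0≤w , nt , nn) =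
    ℚ.+-mono-≤ (ℚ.+-mono-≤ 0≤w (weight-nonNeg t Q nt)) (weightL-nonNeg cs P nn)

tourLength-nonNeg : ∀ t (P : Pruning t) → NonNegWeights t → 0ℚ ≤ tourLength t P
tourLength-nonNeg t P nn = ℚ.+-mono-≤ (weight-nonNeg t P nn) (weight-nonNeg t P nn)

mutual
  tourSteps-nonNeg : ∀ t (P : Pruning t) → NonNegWeights t → All (0ℚ ≤_) (tourSteps t P)
  tourSteps-nonNeg (node cs) P nn = tourStepsL-nonNeg cs P nn

  tourStepsL-nonNeg : ∀ cs (P : PruningL cs) → NonNegWeightsL cs → All (0ℚ ≤_) (tourStepsL cs P)
  tourStepsL-nonNeg []             _              _               = []
  tourStepsL-nonNeg ((w , t) ∷ cs) (nothing , P)  (_ , _ , nn)    = tourStepsL-nonNeg cs P nn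
  tourStepsL-nonNeg ((w , t) ∷ cs) (just Q , P)   (0≤w , nt , nn) =
    0≤w ∷ Allₚ.++⁺ (tourSteps-nonNeg t Q nt) (0≤w ∷ tourStepsL-nonNeg cs P nn)

mutual
  weight-join : ∀ t (P Q : Pruning t) → NonNegWeights t → weight t (join t P Q) ≤ weight t P + weight t Q
  weight-join (node cs) P Q nn = weightL-join cs P Q nn

  weightL-join : ∀ cs (P Q : PruningL cs) → NonNegWeightsL cs →
                 weightL cs (joinL cs P Q) ≤ weightL cs P + weightL cs Q
  weightL-join []             P       Q         nn              = ℚ.≤-refl
  weightL-join ((w , t) ∷ cs) (m , P) (m′ , Q) (0≤w , nt , nn) = begin
    weightM w t (joinM t m m′) + weightL cs (joinL cs P Q)
      ≤⟨ ℚ.+-mono-≤ (weightM-join w t m m′ 0≤w nt) (weightL-join cs P Q nn) ⟩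
    (weightM w t m + weightM w t m′) + (weightL cs P + weightL cs Q)
      ≡⟨ +-interchange (weightM w t m) (weightM w t m′) (weightL cs P) (weightL cs Q) ⟩
    (weightM w t m + weightL cs P) + (weightM w t m′ + weightL cs Q) ∎
    where open ℚ.≤-Reasoning

  weightM-join : ∀ w t (m m′ : Maybe (Pruning t)) → 0ℚ ≤ w → NonNegWeights t →
                 weightM w t (joinM t m m′) ≤ weightM w t m + weightM w t m′
  weightM-join w t nothing  m′        _   _  = ℚ.≤-reflexive (sym (ℚ.+-identityˡ _))
  weightM-join w t (just Q) nothing   _   _  = ℚ.≤-reflexive (sym (ℚ.+-identityʳ _))
  weightM-join w t (just Q) (just Q′) 0≤w nt = begin
    w + weight t (join t Q Q′)        ≤⟨ ℚ.+-monoʳ-≤ w (weight-join t Q Q′ nt) ⟩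
    w + (weight t Q + weight t Q′)    ≤⟨ p≤p+q 0≤w ⟩
    w + (weight t Q + weight t Q′) + w ≡⟨ solve 3 (λ w a b → w :+ (a :+ b) :+ w := (w :+ a) :+ (w :+ b))
                                                 refl w (weight t Q) (weight t Q′) ⟩
    (w + weight t Q) + (w + weight t Q′) ∎
    where open ℚ.≤-Reasoning

branchL : ∀ cs i {w t} → lookupChild cs i ≡ just (w , t) → Pruning t → PruningL cs
branchL ((w , t) ∷ cs) zero    refl Q = just Q , rootOnlyL cs
branchL (c ∷ cs)       (suc i) eq   Q = nothing , branchL cs i eq Q

weight-branchL : ∀ cs i {w t} (i∈cs : lookupChild cs i ≡ just (w , t)) Q →
                 weightL cs (branchL cs i i∈cs Q) ≡ w + weight t Q
weight-branchL ((w , t) ∷ cs) zero    refl Q =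
  trans (cong (w + weight t Q +_) (weight-rootOnlyL cs)) (ℚ.+-identityʳ _)
weight-branchL (c ∷ cs)       (suc i) eq   Q = trans (ℚ.+-identityˡ _) (weight-branchL cs i eq Q)

covers-branchL : ∀ cs i {w t} (i∈cs : lookupChild cs i ≡ just (w , t)) Q y →
                 covers t Q y → coversL cs (branchL cs i i∈cs Q) i y
covers-branchL ((w , t) ∷ cs) zero    refl Q y cov = cov
covers-branchL (c ∷ cs)       (suc i) eq   Q y cov = covers-branchL cs i eq Q y cov

step-from-root : ∀ cs {x y w} → Step (node cs) x y w → x ≡ [] →
                 ∃₂ λ i t → y ≡ [ i ] × lookupChild cs i ≡ just (w , t)
step-from-root cs (down {i = i} refl i∈cs) refl = i , _ , refl , trans (sym (childAt-node cs i)) i∈cs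
step-from-root cs (up {x = []}    _ _) ()
step-from-root cs (up {x = _ ∷ _} _ _) ()

step-from-child : ∀ cs i {w t x₀ x y w′} → lookupChild cs i ≡ just (w , t) →
                  Step (node cs) x₀ y w′ → x₀ ≡ i ∷ x →
                  (∃ λ x′ → y ≡ i ∷ x′ × Step t x x′ w′) ⊎ (x ≡ [] × y ≡ [] × w′ ≡ w)
step-from-child cs i i∈cs (down x∈t j∈s) refl =
  inj₁ (_ , refl , down (trans (sym (subL-lookup cs i _ i∈cs)) x∈t) j∈s)
step-from-child cs i i∈cs (up {x = []} refl j∈s) refl =
  inj₂ (refl , refl , cong proj₁ (Maybe.just-injective (trans (sym j∈s) (trans (childAt-node cs i) i∈cs))))
step-from-child cs i i∈cs (up {x = _ ∷ x} x∈t j∈s) refl =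
  inj₁ (x , refl , up (trans (sym (subL-lookup cs i _ i∈cs)) x∈t) j∈s)

split-excursion : ∀ cs i {w t x vs ws} → lookupChild cs i ≡ just (w , t) →
  Path (node cs) (i ∷ x) [] vs ws →
  ∃₂ λ us ws₁ → ∃₂ λ vs₂ ws₂ →
    Path t x [] us ws₁ × Path (node cs) [] [] vs₂ ws₂ ×
    vs ≡ map (i ∷_) us ++ vs₂ × ws ≡ ws₁ ++ w ∷ ws₂
split-excursion cs i {x = x} i∈cs (st ◅ p) with step-from-child cs i {x = x} i∈cs st refl
... | inj₁ (x′ , refl , st′)
  with us , ws₁ , vs₂ , ws₂ , p₁ , p₂ , refl , refl ← split-excursion cs i i∈cs p
  = x ∷ us , _ ∷ ws₁ , vs₂ , ws₂ , st′ ◅ p₁ , p₂ , refl , refl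
split-excursion cs i {t = t} i∈cs (st ◅ p) | inj₂ (refl , refl , refl) =
  [ [] ] , [] , _ , _ , end (t , refl) , p , refl , refl

tourLength-join : ∀ t (P Q : Pruning t) → NonNegWeights t →
                  tourLength t (join t P Q) ≤ tourLength t P + tourLength t Q
tourLength-join t P Q nn = ℚ.≤-trans (ℚ.+-mono-≤ (weight-join t P Q nn) (weight-join t P Q nn))
  (ℚ.≤-reflexive (+-interchange (weight t P) (weight t Q) (weight t P) (weight t Q)))

CoveringPruning : (t : Tree) → List Pos → ℚ → Set
CoveringPruning t vs L = Σ (Pruning t) λ P → (∀ x → x ∈ vs → covers t P x) × tourLength t P ≤ L

-- The walk is an excursion into some child followed by a shorter closed walk; n bounds its length.
closedPath-pruning : ∀ n cs {vs ws} → length vs ≤ℕ n → NonNegWeightsL cs →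
                     Path (node cs) [] [] vs ws → CoveringPruning (node cs) vs (sumℚ ws)
closedPath-pruning n cs _ nn (end _) =
  rootOnlyL cs , (λ { _ (here refl) → tt }) ,
  ℚ.≤-reflexive (cong₂ _+_ (weight-rootOnlyL cs) (weight-rootOnlyL cs))
closedPath-pruning (suc n) cs (s≤s |vs|≤n) nn (_◅_ {w = w} st p)
  with i , node cs′ , refl , i∈cs ← step-from-root cs st refl
  with us , ws₁ , vs₂ , ws₂ , p₁ , p₂ , refl , refl ← split-excursion cs i i∈cs p
  = joinL cs P₂ (branchL cs i i∈cs P₁) , covered , bound
  where
  |us|+|vs₂|≤n : length us +ℕ length vs₂ ≤ℕ n
  |us|+|vs₂|≤n = subst (_≤ℕ n)
    (trans (List.length-++ (map (i ∷_) us)) (cong (_+ℕ length vs₂) (List.length-map (i ∷_) us))) |vs|≤n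
  nn-child = proj₂ (nonNegWeights-lookup cs i nn i∈cs)
  child = closedPath-pruning n cs′ (ℕ.≤-trans (ℕ.m≤m+n _ _) |us|+|vs₂|≤n) nn-child p₁
  rest  = closedPath-pruning n cs  (ℕ.≤-trans (ℕ.m≤n+m _ _) |us|+|vs₂|≤n) nn p₂
  P₁ = proj₁ child
  P₂ = proj₁ rest
  S  = branchL cs i i∈cs P₁

  covered : ∀ x → x ∈ [] ∷ (map (i ∷_) us ++ vs₂) → covers (node cs) (joinL cs P₂ S) x
  covered _ (here refl) = tt
  covered x (there x∈) with ∈-++⁻ (map (i ∷_) us) x∈
  ... | inj₁ x∈us with u , u∈us , refl ← ∈-map⁻ (i ∷_) x∈us =
    covers-joinʳ (node cs) P₂ S (i ∷ u) (covers-branchL cs i i∈cs P₁ u (proj₁ (proj₂ child) u u∈us))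
  ... | inj₂ x∈vs₂ = covers-joinˡ (node cs) P₂ S x (proj₁ (proj₂ rest) x x∈vs₂)

  a = tourLength (node cs) P₂
  b = weight (node cs′) P₁

  bound : tourLength (node cs) (joinL cs P₂ S) ≤ w + sumℚ (ws₁ ++ w ∷ ws₂)
  bound = begin
    tourLength (node cs) (joinL cs P₂ S)  ≤⟨ tourLength-join (node cs) P₂ S nn ⟩
    a + tourLength (node cs) S            ≡⟨ cong (λ z → a + (z + z)) (weight-branchL cs i i∈cs P₁) ⟩
    a + ((w + b) + (w + b))               ≡⟨ solve 3 (λ a w b → a :+ ((w :+ b) :+ (w :+ b)) := w :+ ((b :+ b) :+ (w :+ a)))
                                                   refl a w b ⟩
    w + ((b + b) + (w + a))               ≤⟨ ℚ.+-monoʳ-≤ w (ℚ.+-mono-≤ (proj₂ (proj₂ child))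
                                                                      (ℚ.+-monoʳ-≤ w (proj₂ (proj₂ rest)))) ⟩
    w + (sumℚ ws₁ + (w + sumℚ ws₂))       ≡⟨ cong (w +_) (sym (sumℚ-++ ws₁ (w ∷ ws₂))) ⟩
    w + sumℚ (ws₁ ++ w ∷ ws₂)             ∎
    where open ℚ.≤-Reasoning

route-pruning : ∀ t {vs L} → NonNegWeights t → IsRoute t vs L → CoveringPruning t vs L
route-pruning (node cs) {x ∷ vs} nn (walk , refl , last≡)
  with y , ws , p , refl ← walk⇒path walk
  with refl ← trans (sym (path-last p)) last≡
  = closedPath-pruning (length (x ∷ vs)) cs ℕ.≤-refl nn p

vertex-pruning : ∀ t x → Vertex t x → Σ (Pruning t) λ P → covers t P x × weight t P ≡ depth t x
vertex-pruning (node cs) []      _ = rootOnlyL cs , tt , weight-rootOnlyL cs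
vertex-pruning (node cs) (i ∷ y) (s , y∈t)
  with w , t′ , i∈cs , y∈t′ ← subL-lookup⁻ cs i y y∈t
  with Q , cov , weight≡ ← vertex-pruning t′ y (s , y∈t′)
  = branchL cs i i∈cs Q , covers-branchL cs i i∈cs Q y cov ,
    trans (weight-branchL cs i i∈cs Q) (trans (cong (w +_) weight≡) (sym (depthL-lookup cs i y i∈cs)))

covers-wholeL : ∀ cs i {w t} → lookupChild cs i ≡ just (w , t) →
                ∀ y → covers t (whole t) y → coversL cs (wholeL cs) i y
covers-wholeL ((w , t) ∷ cs) zero    refl y cov = cov
covers-wholeL (c ∷ cs)       (suc i) eq   y cov = covers-wholeL cs i eq y cov

covers-whole : ∀ t x → Vertex t x → covers t (whole t) x
covers-whole (node cs) []      _ = tt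
covers-whole (node cs) (i ∷ y) (s , y∈t)
  with w , t′ , i∈cs , y∈t′ ← subL-lookup⁻ cs i y y∈t
  = covers-wholeL cs i i∈cs y (covers-whole t′ y (s , y∈t′))

covers-all⇒whole : ∀ t (P : Pruning t) → (∀ x → Vertex t x → covers t P x) → P ≡ whole t
covers-all⇒whole (node [])                      tt           _   = refl
covers-all⇒whole (node ((w , node cs′) ∷ cs)) (nothing , P) all = ⊥-elim (all [ 0 ] (node cs′ , refl))
covers-all⇒whole (node ((w , node cs′) ∷ cs)) (just Q , P)  all =
  cong₂ _,_ (cong just (covers-all⇒whole (node cs′) Q (λ x → all (0 ∷ x))))
            (covers-all⇒whole (node cs) P all-rest)
  where
  all-rest : ∀ x → Vertex (node cs) x → covers (node cs) P x
  all-rest []      _ = tt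
  all-rest (k ∷ y) v = all (suc k ∷ y) v

mutual
  pruning-≟ : ∀ t → DecidableEquality (Pruning t)
  pruning-≟ (node cs) = pruningL-≟ cs

  pruningL-≟ : ∀ cs → DecidableEquality (PruningL cs)
  pruningL-≟ []             tt tt = yes refl
  pruningL-≟ ((_ , t) ∷ cs)       = Product.≡-dec (Maybe.≡-dec (pruning-≟ t)) (pruningL-≟ cs)

mutual
  allPrunings : (t : Tree) → List (Pruning t)
  allPrunings (node cs) = allPruningsL cs

  allPruningsL : (cs : List (ℚ × Tree)) → List (PruningL cs)
  allPruningsL []             = [ tt ]
  allPruningsL ((w , t) ∷ cs) = cartesianProduct (nothing ∷ map just (allPrunings t)) (allPruningsL cs)

mutual
  ∈-allPrunings : ∀ t (P : Pruning t) → P ∈ allPrunings t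
  ∈-allPrunings (node cs) P = ∈-allPruningsL cs P

  ∈-allPruningsL : ∀ cs (P : PruningL cs) → P ∈ allPruningsL cs
  ∈-allPruningsL []             tt            = here refl
  ∈-allPruningsL ((w , t) ∷ cs) (nothing , P) =
    ∈-cartesianProduct⁺ {xs = nothing ∷ map just (allPrunings t)} (here refl) (∈-allPruningsL cs P)
  ∈-allPruningsL ((w , t) ∷ cs) (just Q , P)  =
    ∈-cartesianProduct⁺ {xs = nothing ∷ map just (allPrunings t)}
      (there (∈-map⁺ just (∈-allPrunings t Q))) (∈-allPruningsL cs P)


-- Optimal explorations

join⁺ : ∀ t → Pruning t → List (Pruning t) → Pruning t
join⁺ t P []      = P
join⁺ t P (Q ∷ F) = join t P (join⁺ t Q F)

covers-join⁺⁻ : ∀ t P F x → covers t (join⁺ t P F) x → Any (λ Q → covers t Q x) (P ∷ F)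
covers-join⁺⁻ t P []      x cov = here cov
covers-join⁺⁻ t P (Q ∷ F) x cov with covers-join⁻ t P (join⁺ t Q F) x cov
... | inj₁ covP = here covP
... | inj₂ covF = there (covers-join⁺⁻ t Q F x covF)

covers-join⁺ : ∀ t P F x → Any (λ Q → covers t Q x) (P ∷ F) → covers t (join⁺ t P F) x
covers-join⁺ t P []      x (here cov)  = cov
covers-join⁺ t P (Q ∷ F) x (here cov)  = covers-joinˡ t P (join⁺ t Q F) x cov
covers-join⁺ t P (Q ∷ F) x (there cov) = covers-joinʳ t P (join⁺ t Q F) x (covers-join⁺ t Q F x cov)

CoversAll : (t : Tree) → List (Pruning t) → Set
CoversAll t F = ∀ x → Vertex t x → Any (λ P → covers t P x) F

-- Covering every vertex is decidable although there are infinitely many positions: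
-- it says exactly that the union of the family is the whole tree.
coversAll? : ∀ t F → Dec (CoversAll t F)
coversAll? t []      = no (λ all → Anyₚ.¬Any[] (all [] (t , refl)))
coversAll? t (P ∷ F) = map′
  (λ join≡whole x v → covers-join⁺⁻ t P F x (subst (λ Q → covers t Q x) (sym join≡whole) (covers-whole t x v)))
  (λ all → covers-all⇒whole t (join⁺ t P F) (λ x v → covers-join⁺ t P F x (all x v)))
  (pruning-≟ t (join⁺ t P F) (whole t))

Explores : ℚ → (t : Tree) → List (Pruning t) → Set
Explores β t F = All (λ P → tourLength t P ≤ β) F × CoversAll t F

explores? : ∀ β t F → Dec (Explores β t F)
explores? β t F = All.all? (λ P → tourLength t P ≤? β) F ×-dec coversAll? t F

familyCost : (t : Tree) → List (Pruning t) → ℚ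
familyCost t F = sumℚ (map (tourLength t) F)

IsOptFamilyCost : ℚ → Tree → ℚ → Set
IsOptFamilyCost β t c =
  Σ (List (Pruning t)) (λ F → Explores β t F × familyCost t F ≡ c) ×
  (∀ F → Explores β t F → c ≤ familyCost t F)

module _ (t : Tree) where

  open DecMembership (pruning-≟ t) using (_∈?_)

  distinctPrunings : List (Pruning t)
  distinctPrunings = deduplicate (pruning-≟ t) (allPrunings t)

  ∈-distinctPrunings : ∀ P → P ∈ distinctPrunings
  ∈-distinctPrunings P = ∈-deduplicate⁺ (pruning-≟ t) (∈-allPrunings t P)

  -- Repeating a pruning only adds cost, so optima can be sought among sets of prunings.
  restrict : List (Pruning t) → List (Pruning t)
  restrict F = filter (_∈? F) distinctPrunings

  restrict-explores : ∀ {β} F → Explores β t F → Explores β t (restrict F)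
  restrict-explores F (short , all) =
    All.tabulate (λ P∈ → All.lookup short (proj₂ (∈-filter⁻ (_∈? F) {xs = distinctPrunings} P∈))) ,
    λ x v → let P , P∈F , cov = find (all x v)
            in lose (∈-filter⁺ (_∈? F) (∈-distinctPrunings P) P∈F) cov

  familyCost-restrict : ∀ F → NonNegWeights t → familyCost t (restrict F) ≤ familyCost t F
  familyCost-restrict F nn =
    sum-map-mono-⊆ (tourLength t) (λ P → tourLength-nonNeg t P nn)
      (Unique.filter⁺ (_∈? F) (deduplicate-! (pruning-≟ t) (allPrunings t)))
      (λ P∈ → proj₂ (∈-filter⁻ (_∈? F) {xs = distinctPrunings} P∈))

  explorers : ℚ → List (List (Pruning t))
  explorers β = filter (explores? β t) (sublists distinctPrunings)

  restrict∈explorers : ∀ {β} F → Explores β t F → restrict F ∈ explorers β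
  restrict∈explorers {β} F ex =
    ∈-filter⁺ (explores? β t) (filter∈sublists (_∈? F) distinctPrunings) (restrict-explores F ex)

  shortPrunings : ℚ → List (Pruning t)
  shortPrunings β = filter (λ P → tourLength t P ≤? β) distinctPrunings

  shortPrunings-explores : ∀ β → Explorable β t → Explores β t (shortPrunings β)
  shortPrunings-explores β explorable =
    All.tabulate (λ P∈ → proj₂ (∈-filter⁻ (λ P → tourLength t P ≤? β) {xs = distinctPrunings} P∈)) ,
    λ x v → let P , cov , weight≡ = vertex-pruning t x v
            in lose (∈-filter⁺ (λ P → tourLength t P ≤? β) (∈-distinctPrunings P)
                      (subst (λ d → d + d ≤ β) (sym weight≡) (explorable x v))) cov

  optimalFamily : ∀ β → NonNegWeights t → Explorable β t → Σ ℚ (IsOptFamilyCost β t)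
  optimalFamily β nn explorable = familyCost t best , (best , best-explores , refl) , best-minimal
    where
    open Data.List.Extrema (DecTotalOrder.totalOrder ℚ.≤-decTotalOrder)
    best = argmin (familyCost t) (shortPrunings β) (explorers β)
    best-explores : Explores β t best
    best-explores = argmin-all (familyCost t) (shortPrunings-explores β explorable)
      (All.tabulate (λ F∈ → proj₂ (∈-filter⁻ (explores? β t) {xs = sublists distinctPrunings} F∈)))
    best-minimal : ∀ F → Explores β t F → familyCost t best ≤ familyCost t F
    best-minimal F ex = ℚ.≤-trans
      (All.lookup (f[argmin]≤f[xs] {f = familyCost t} (shortPrunings β) (explorers β)) (restrict∈explorers F ex))
      (familyCost-restrict F nn)

strategy : (t : Tree) → List (Pruning t) → Strategy
strategy t = map (λ P → tour t P , sumℚ (tourSteps t P))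

cost-strategy : ∀ t F → cost (strategy t F) ≡ familyCost t F
cost-strategy t []      = refl
cost-strategy t (P ∷ F) = cong₂ _+_ (sum-tourSteps t P) (cost-strategy t F)

module _ {β : ℚ} (t : Tree) where

  RouteWithin : List Pos × ℚ → Set
  RouteWithin r = IsRoute t (proj₁ r) (proj₂ r) × proj₂ r ≤ β

  strategy-explores : ∀ F → Explores β t F → IsExploration β t (strategy t F)
  strategy-explores F (short , all) = routes F short , λ x v → visits F x (all x v)
    where
    routes : ∀ F → All (λ P → tourLength t P ≤ β) F → All RouteWithin (strategy t F)
    routes []      []        = []
    routes (P ∷ F) (P≤ ∷ F≤) = (tour-route t P , subst (_≤ β) (sym (sum-tourSteps t P)) P≤) ∷ routes F F≤
    visits : ∀ F x → Any (λ P → covers t P x) F → Any (λ r → x ∈ proj₁ r) (strategy t F)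
    visits (P ∷ F) x (here cov) = here (covers⇒∈tour t P x cov)
    visits (P ∷ F) x (there c)  = there (visits F x c)

  module _ (nn : NonNegWeights t) where

    routePrunings : ∀ {s} → All RouteWithin s → List (Pruning t)
    routePrunings []                 = []
    routePrunings ((route , _) ∷ rs) = proj₁ (route-pruning t nn route) ∷ routePrunings rs

    routePrunings-explores : ∀ {s} (rs : All RouteWithin s) →
                             (∀ x → Vertex t x → Any (λ r → x ∈ proj₁ r) s) → Explores β t (routePrunings rs)
    routePrunings-explores rs visits = short rs , λ x v → covering rs x (visits x v)
      where
      short : ∀ {s} (rs : All RouteWithin s) → All (λ P → tourLength t P ≤ β) (routePrunings rs)
      short []                  = []
      short ((route , L≤β) ∷ rs) = ℚ.≤-trans (proj₂ (proj₂ (route-pruning t nn route))) L≤β ∷ short rs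
      covering : ∀ {s} (rs : All RouteWithin s) x → Any (λ r → x ∈ proj₁ r) s →
                 Any (λ P → covers t P x) (routePrunings rs)
      covering ((route , _) ∷ rs) x (here x∈) = here (proj₁ (proj₂ (route-pruning t nn route)) x x∈)
      covering (_ ∷ rs)           x (there v) = there (covering rs x v)

    familyCost-routePrunings : ∀ {s} (rs : All RouteWithin s) → familyCost t (routePrunings rs) ≤ cost s
    familyCost-routePrunings []                = ℚ.≤-refl
    familyCost-routePrunings ((route , _) ∷ rs) =
      ℚ.+-mono-≤ (proj₂ (proj₂ (route-pruning t nn route))) (familyCost-routePrunings rs)

    isOptFamilyCost⇒isOptCost : ∀ {c} → IsOptFamilyCost β t c → IsOptCost β t c
    isOptFamilyCost⇒isOptCost ((F , explores , refl) , minimal) =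
      (strategy t F , strategy-explores F explores , cost-strategy t F) ,
      λ s (rs , visits) → ℚ.≤-trans (minimal (routePrunings rs) (routePrunings-explores rs visits))
                                    (familyCost-routePrunings rs)

module FirstEdge (w : ℚ) (t : Tree) (es : List (ℚ × Tree)) where

  T₁ = edgeTree (w , t)
  T₂ = node es
  T  = node ((w , t) ∷ es)

  first : Pruning T → Pruning T₁
  first (m , _) = m , tt

  others : Pruning T → Pruning T₂
  others (_ , P) = P

  fromFirst : Pruning T₁ → Pruning T
  fromFirst (m , _) = m , rootOnlyL es

  fromOthers : Pruning T₂ → Pruning T
  fromOthers P = nothing , P

  tourLength-split : ∀ P → tourLength T P ≡ tourLength T₁ (first P) + tourLength T₂ (others P)
  tourLength-split (m , P) =
    trans (cong (λ a → (a + weightL es P) + (a + weightL es P)) (sym (ℚ.+-identityʳ (weightM w t m))))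
          (+-interchange (weightM w t m + 0ℚ) (weightL es P) (weightM w t m + 0ℚ) (weightL es P))

  familyCost-split : ∀ F → familyCost T F ≡ familyCost T₁ (map first F) + familyCost T₂ (map others F)
  familyCost-split []      = sym (ℚ.+-identityˡ 0ℚ)
  familyCost-split (P ∷ F) = trans (cong₂ _+_ (tourLength-split P) (familyCost-split F))
    (+-interchange (tourLength T₁ (first P)) (tourLength T₂ (others P)) _ _)

  tourLength-fromFirst : ∀ P → tourLength T (fromFirst P) ≡ tourLength T₁ P
  tourLength-fromFirst (m , _) = cong (λ z → (weightM w t m + z) + (weightM w t m + z)) (weight-rootOnlyL es)

  tourLength-fromOthers : ∀ P → tourLength T (fromOthers P) ≡ tourLength T₂ P
  tourLength-fromOthers P = cong₂ _+_ (ℚ.+-identityˡ (weightL es P)) (ℚ.+-identityˡ (weightL es P))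

  module _ {β : ℚ} (nn : NonNegWeights T) where

    explores-first : ∀ F → Explores β T F → Explores β T₁ (map first F)
    explores-first F (short , all) = Allₚ.map⁺ (All.map (λ {P} → shorter P) short) , all₁
      where
      shorter : ∀ P → tourLength T P ≤ β → tourLength T₁ (first P) ≤ β
      shorter P P≤β = ℚ.≤-trans (subst (tourLength T₁ (first P) ≤_) (sym (tourLength-split P))
                                  (p≤p+q (tourLength-nonNeg T₂ (others P) (nonNegWeights-tail {w} {t} {es} nn)))) P≤β
      all₁ : CoversAll T₁ (map first F)
      all₁ []          _       = Anyₚ.map⁺ (Any.map (λ _ → tt) (all [] (T , refl)))
      all₁ (zero ∷ y)  v       = Anyₚ.map⁺ (Any.map (λ {P} → covers-first P) (all (zero ∷ y) v))
        where
        covers-first : ∀ P → covers T P (zero ∷ y) → covers T₁ (first P) (zero ∷ y)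
        covers-first _ cov = cov
      all₁ (suc _ ∷ _) (_ , ())

    explores-others : ∀ F → Explores β T F → Explores β T₂ (map others F)
    explores-others F (short , all) = Allₚ.map⁺ (All.map (λ {P} → shorter P) short) , all₂
      where
      shorter : ∀ P → tourLength T P ≤ β → tourLength T₂ (others P) ≤ β
      shorter P P≤β = ℚ.≤-trans (subst (tourLength T₂ (others P) ≤_) (sym (tourLength-split P))
                                  (p≤q+p (tourLength-nonNeg T₁ (first P) (nonNegWeights-head {w} {t} {es} nn)))) P≤β
      all₂ : CoversAll T₂ (map others F)
      all₂ []      _ = Anyₚ.map⁺ (Any.map (λ _ → tt) (all [] (T , refl)))
      all₂ (k ∷ y) v = Anyₚ.map⁺ (Any.map (λ {P} → covers-others P) (all (suc k ∷ y) v))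
        where
        covers-others : ∀ P → covers T P (suc k ∷ y) → covers T₂ (others P) (k ∷ y)
        covers-others _ cov = cov

  combine : List (Pruning T₁) → List (Pruning T₂) → List (Pruning T)
  combine F₁ F₂ = map fromFirst F₁ ++ map fromOthers F₂

  familyCost-map : ∀ t₀ (f : Pruning t₀ → Pruning T) → (∀ P → tourLength T (f P) ≡ tourLength t₀ P) →
                   ∀ F → familyCost T (map f F) ≡ familyCost t₀ F
  familyCost-map t₀ f f≡ []      = refl
  familyCost-map t₀ f f≡ (P ∷ F) = cong₂ _+_ (f≡ P) (familyCost-map t₀ f f≡ F)

  familyCost-combine : ∀ F₁ F₂ → familyCost T (combine F₁ F₂) ≡ familyCost T₁ F₁ + familyCost T₂ F₂
  familyCost-combine F₁ F₂ = trans (sum-map-++ (tourLength T) (map fromFirst F₁) (map fromOthers F₂))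
    (cong₂ _+_ (familyCost-map T₁ fromFirst tourLength-fromFirst F₁)
               (familyCost-map T₂ fromOthers tourLength-fromOthers F₂))

  explores-combine : ∀ {β} F₁ F₂ → Explores β T₁ F₁ → Explores β T₂ F₂ →
                     Explores β T (combine F₁ F₂)
  explores-combine {β} F₁ F₂ (short₁ , all₁) (short₂ , all₂) =
    Allₚ.++⁺ (Allₚ.map⁺ (All.map (λ {P} → subst (_≤ β) (sym (tourLength-fromFirst P))) short₁))
            (Allₚ.map⁺ (All.map (λ {P} → subst (_≤ β) (sym (tourLength-fromOthers P))) short₂)) ,
    all
    where
    all : CoversAll T (combine F₁ F₂)
    all []          _ = Anyₚ.++⁺ˡ (Anyₚ.map⁺ (Any.map (λ _ → tt) (all₁ [] (T₁ , refl))))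
    all (zero ∷ y)  v = Anyₚ.++⁺ˡ (Anyₚ.map⁺ (Any.map (λ {P} → covers-fromFirst P) (all₁ (zero ∷ y) v)))
      where
      covers-fromFirst : ∀ P → covers T₁ P (zero ∷ y) → covers T (fromFirst P) (zero ∷ y)
      covers-fromFirst _ cov = cov
    all (suc k ∷ y) v = Anyₚ.++⁺ʳ (map fromFirst F₁) (Anyₚ.map⁺ (all₂ (k ∷ y) v))

  isOptFamilyCost-split : ∀ {β c c₁ c₂} → NonNegWeights T →
    IsOptFamilyCost β T c → IsOptFamilyCost β T₁ c₁ → IsOptFamilyCost β T₂ c₂ → c ≡ c₁ + c₂
  isOptFamilyCost-split nn ((F , ex , refl) , min) ((F₁ , ex₁ , refl) , min₁) ((F₂ , ex₂ , refl) , min₂) =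
    ℚ.≤-antisym
      (ℚ.≤-trans (min (combine F₁ F₂) (explores-combine F₁ F₂ ex₁ ex₂))
                 (ℚ.≤-reflexive (familyCost-combine F₁ F₂)))
      (ℚ.≤-trans (ℚ.+-mono-≤ (min₁ (map first F) (explores-first nn F ex))
                             (min₂ (map others F) (explores-others nn F ex)))
                 (ℚ.≤-reflexive (sym (familyCost-split F))))

isOptFamilyCost-leaf : ∀ {β} → Explorable β (node []) → IsOptFamilyCost β (node []) 0ℚ
isOptFamilyCost-leaf explorable =
  ([ tt ] , (explorable [] (node [] , refl) ∷ [] , λ { [] _ → here tt }) , refl) ,
  λ F _ → sum-map-nonNeg (tourLength (node [])) F (λ P → tourLength-nonNeg (node []) P tt)

optimalCost-children : ∀ β es → NonNegWeights (node es) → Explorable β (node es) →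
  Σ ℚ λ c → Σ (List ℚ) λ cs →
    IsOptFamilyCost β (node es) c × Pointwise (λ e cₑ → IsOptCost β (edgeTree e) cₑ) es cs × c ≡ sumℚ cs
optimalCost-children β [] _ explorable = 0ℚ , [] , isOptFamilyCost-leaf explorable , [] , refl
optimalCost-children β ((w , t) ∷ es) nn explorable
  with c₂ , cs , opt₂ , opts , refl ←
         optimalCost-children β es (nonNegWeights-tail {w} {t} {es} nn) (explorable-tail explorable)
  = let c  , opt  = optimalFamily T β nn explorable
        c₁ , opt₁ = optimalFamily T₁ β nn₁ (explorable-head explorable)
    in c , c₁ ∷ cs , opt , isOptFamilyCost⇒isOptCost T₁ nn₁ opt₁ ∷ opts ,
       isOptFamilyCost-split nn opt opt₁ opt₂
  where
  open FirstEdge w t es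
  nn₁ : NonNegWeights T₁
  nn₁ = nonNegWeights-head {w} {t} {es} nn


-- Adversarial DFS on an abstract traversal

-- ADFS on an abstract DFS traversal v₀ … v_l: D p = d(r, v_p) and len a p = len(v_a, …, v_p).
module ADFSModel (β : ℚ) (l : ℕ) (D : ℕ → ℚ) (len : ℕ → ℕ → ℚ) where

  Largest : (ℕ → Set) → ℕ → Set
  Largest P j = j ≤ℕ l × P j × (∀ p → j <ℕ p → p ≤ℕ l → ¬ P p)

  -- A route currently at v_a with r left for the rest of it can walk on to v_p and return.
  Fits : ℕ → ℚ → ℕ → Set
  Fits a r p = a ≤ℕ p × len a p + D p ≤ r

  fits? : ∀ a r → Decidable (Fits a r)
  fits? a r p = (a ℕ.≤? p) ×-dec (len a p + D p ≤? r)

  data Chain : ℕ → ℚ → Set where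
    stop : ∀ {a} → a ≡ l → Chain a 0ℚ
    next : ∀ {a j c} → a ≢ l → Largest (Fits a (β - D a)) j → Chain j c →
           Chain a (D a + len a j + D j + c)

  -- ADFS resumed at v_a with r left for the current route; Run 0 B′ is ADFS_{B′}.
  Run : ℕ → ℚ → ℚ → Set
  Run a r c = Σ ℕ λ j → Σ ℚ λ c′ → Largest (Fits a r) j × Chain j c′ × c ≡ len a j + D j + c′

  MaxRunCost : ℚ → Set
  MaxRunCost c = Σ ℚ (λ B′ → 0ℚ ≤ B′ × B′ ≤ β × Run 0 B′ c) ×
                 (∀ B′ c′ → 0ℚ ≤ B′ → B′ ≤ β → Run 0 B′ c′ → c′ ≤ c)

  next′ : ∀ {a c} → a ≢ l → Run a (β - D a) c → Chain a (D a + c)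
  next′ {a} a≢l (j , c′ , lg , ch , refl) =
    subst (Chain a) (p+q+r+s≡p+[q+r+s] (D a) (len a j) (D j) c′) (next a≢l lg ch)

  largest-unique : ∀ {P j j′} → Largest P j → Largest P j′ → j ≡ j′
  largest-unique {j = j} {j′} (j≤l , Pj , maxj) (j′≤l , Pj′ , maxj′) with ℕ.<-cmp j j′
  ... | tri< j<j′ _ _ = ⊥-elim (maxj j′ j<j′ j′≤l Pj′)
  ... | tri≈ _ j≡j′ _ = j≡j′
  ... | tri> _ _ j′<j = ⊥-elim (maxj′ j j′<j j≤l Pj)

  largest-exists : ∀ {P} → Decidable P → ∀ k → k ≤ℕ l → P k → Σ ℕ (Largest P)
  largest-exists {P} P? k k≤l Pk = j , j≤l , Pj , maximal
    where
    open Data.List.Extrema ℕ.≤-totalOrder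
    candidates = filter P? (upTo (suc l))
    j = argmax id k candidates
    j≤l : j ≤ℕ l
    j≤l = argmax-all id k≤l (All.tabulate (λ p∈ → ℕ.≤-pred (∈-upTo⁻ (proj₁ (∈-filter⁻ P? p∈)))))
    Pj : P j
    Pj = argmax-all id Pk (All.tabulate (λ p∈ → proj₂ (∈-filter⁻ P? {xs = upTo (suc l)} p∈)))
    maximal : ∀ p → j <ℕ p → p ≤ℕ l → ¬ P p
    maximal p j<p p≤l Pp =
      ℕ.<⇒≱ j<p (All.lookup (f[xs]≤f[argmax] {f = id} k candidates) (∈-filter⁺ P? (∈-upTo⁺ (s≤s p≤l)) Pp))

  chain-unique : ∀ {a c c′} → Chain a c → Chain a c′ → c ≡ c′
  chain-unique (stop _)        (stop _)          = refl
  chain-unique (stop a≡l)      (next a≢l _ _)    = ⊥-elim (a≢l a≡l)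
  chain-unique (next a≢l _ _)  (stop a≡l)        = ⊥-elim (a≢l a≡l)
  chain-unique (next _ lg ch)  (next _ lg′ ch′)
    with refl ← largest-unique lg lg′
    with refl ← chain-unique ch ch′ = refl

  run-unique : ∀ {a r c c′} → Run a r c → Run a r c′ → c ≡ c′
  run-unique (_ , _ , lg , ch , refl) (_ , _ , lg′ , ch′ , refl)
    with refl ← largest-unique lg lg′
    with refl ← chain-unique ch ch′ = refl

record Admissible (β : ℚ) (l : ℕ) (D : ℕ → ℚ) (len : ℕ → ℕ → ℚ) : Set where
  field
    len-refl    : ∀ a → len a a ≡ 0ℚ
    len-nonNeg  : ∀ a p → 0ℚ ≤ len a p
    D-nonNeg    : ∀ p → 0ℚ ≤ D p
    D-start     : D 0 ≡ 0ℚ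
    D-end       : D l ≡ 0ℚ
    round-trip  : ∀ p → p ≤ℕ l → D p + D p ≤ β
    step-within : ∀ p → p <ℕ l → D p + len p (suc p) + D (suc p) ≤ β

module Admissible⇒ {β : ℚ} {l : ℕ} {D : ℕ → ℚ} {len : ℕ → ℕ → ℚ} (adm : Admissible β l D len) where
  open Admissible adm public
  open ADFSModel β l D len

  fits-self : ∀ a {r} → D a ≤ r → Fits a r a
  fits-self a {r} Da≤r =
    ℕ.≤-refl , subst (_≤ r) (sym (trans (cong (_+ D a) (len-refl a)) (ℚ.+-identityˡ (D a)))) Da≤r

  0≤β : 0ℚ ≤ β
  0≤β = subst (_≤ β) (cong₂ _+_ D-start D-start) (round-trip 0 z≤n)

  -- Each route makes progress, since the next vertex fits into a fresh route.
  chain-exists : ∀ n a → l ∸ a ≤ℕ n → a ≤ℕ l → Σ ℚ (Chain a)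
  chain-exists n a l∸a≤n a≤l with a ℕ.≟ l
  ... | yes a≡l = 0ℚ , stop a≡l
  ... | no  a≢l = continue n l∸a≤n (largest-exists (fits? a (β - D a)) a a≤l
                                       (fits-self a (p+q≤r⇒q≤r-p (round-trip a a≤l))))
    where
    a<l = ℕ.≤∧≢⇒< a≤l a≢l
    a+1-fits : Fits a (β - D a) (suc a)
    a+1-fits = ℕ.n≤1+n a , p+q≤r⇒q≤r-p (subst (_≤ β) (ℚ.+-assoc (D a) _ _) (step-within a a<l))
    l∸j<l∸a : ∀ {j} → Largest (Fits a (β - D a)) j → l ∸ j <ℕ l ∸ a
    l∸j<l∸a (j≤l , _ , maxj) = ℕ.∸-monoʳ-< (ℕ.≰⇒> (λ j≤a → maxj (suc a) (s≤s j≤a) a<l a+1-fits)) j≤l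
    continue : ∀ n → l ∸ a ≤ℕ n → Σ ℕ (Largest (Fits a (β - D a))) → Σ ℚ (Chain a)
    continue zero    l∸a≤0   (j , lg) = ⊥-elim (ℕ.<⇒≱ (ℕ.≤-<-trans z≤n (l∸j<l∸a lg)) l∸a≤0)
    continue (suc n) l∸a≤1+n (j , lg) =
      _ , next a≢l lg (proj₂ (chain-exists n j (ℕ.≤-pred (ℕ.≤-trans (l∸j<l∸a lg) l∸a≤1+n)) (proj₁ lg)))

  run-exists : ∀ a r → a ≤ℕ l → D a ≤ r → Σ ℚ (Run a r)
  run-exists a r a≤l Da≤r with j , lg ← largest-exists (fits? a r) a a≤l (fits-self a Da≤r)
    with c′ , ch ← chain-exists (l ∸ j) j ℕ.≤-refl (proj₁ lg)
    = len a j + D j + c′ , j , c′ , lg , ch , refl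

  -- A run is determined by its first turning point j₁, and the budget len 0 j₁ + D j₁ already yields it.
  maximal-run : Σ ℚ MaxRunCost
  maximal-run = costFor k , (budgetFor k , budgetFor-nonNeg k , proj₂ (argmax-all costFor fits-0 all-fit) ,
                             proj₂ (run-exists 0 (budgetFor k) z≤n (D-start≤budgetFor k))) ,
                bounded
    where
    open Data.List.Extrema (DecTotalOrder.totalOrder ℚ.≤-decTotalOrder)
    budgetFor : ℕ → ℚ
    budgetFor p = len 0 p + D p
    budgetFor-nonNeg : ∀ p → 0ℚ ≤ budgetFor p
    budgetFor-nonNeg p = ℚ.+-mono-≤ (len-nonNeg 0 p) (D-nonNeg p)
    D-start≤budgetFor : ∀ p → D 0 ≤ budgetFor p
    D-start≤budgetFor p = subst (_≤ budgetFor p) (sym D-start) (budgetFor-nonNeg p)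
    costFor : ℕ → ℚ
    costFor p = proj₁ (run-exists 0 (budgetFor p) z≤n (D-start≤budgetFor p))
    candidates = filter (fits? 0 β) (upTo (suc l))
    fits-0 : Fits 0 β 0
    fits-0 = fits-self 0 (subst (_≤ β) (sym D-start) 0≤β)
    all-fit : All (Fits 0 β) candidates
    all-fit = All.tabulate (λ p∈ → proj₂ (∈-filter⁻ (fits? 0 β) {xs = upTo (suc l)} p∈))
    k = argmax costFor 0 candidates
    bounded : ∀ B′ c′ → 0ℚ ≤ B′ → B′ ≤ β → Run 0 B′ c′ → c′ ≤ costFor k
    bounded B′ c′ _ B′≤β (j , c″ , (j≤l , (_ , fits-j) , maxj) , ch , c′≡) = begin
      c′         ≡⟨ run-unique run-j (proj₂ (run-exists 0 (budgetFor j) z≤n (D-start≤budgetFor j))) ⟩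
      costFor j  ≤⟨ All.lookup (f[xs]≤f[argmax] {f = costFor} 0 candidates)
                               (∈-filter⁺ (fits? 0 β) (∈-upTo⁺ (s≤s j≤l)) (z≤n , ℚ.≤-trans fits-j B′≤β)) ⟩
      costFor k  ∎
      where
      open ℚ.≤-Reasoning
      run-j : Run 0 (budgetFor j) c′
      run-j = j , c″ , (j≤l , (z≤n , ℚ.≤-refl) ,
                        λ p j<p p≤l (_ , fits-p) → maxj p j<p p≤l (z≤n , ℚ.≤-trans fits-p fits-j)) ,
              ch , c′≡

-- X is the traversal A followed by the traversal B, glued at index m (the end of A, the start of B).
module Concatenation
  {β : ℚ} {m n : ℕ} {DA DB DX : ℕ → ℚ} {lenA lenB lenX : ℕ → ℕ → ℚ}
  (admA : Admissible β m DA lenA) (admB : Admissible β n DB lenB)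
  (D-left     : ∀ p → p ≤ℕ m → DX p ≡ DA p)
  (D-right    : ∀ q → DX (m +ℕ q) ≡ DB q)
  (len-left   : ∀ a p → a ≤ℕ p → p ≤ℕ m → lenX a p ≡ lenA a p)
  (len-across : ∀ a q → a ≤ℕ m → lenX a (m +ℕ q) ≡ lenA a m + lenB 0 q)
  (len-right  : ∀ a p → lenX (m +ℕ a) (m +ℕ p) ≡ lenB a p)
  where

  module A = ADFSModel β m DA lenA
  module B = ADFSModel β n DB lenB
  module X = ADFSModel β (m +ℕ n) DX lenX
  module A⇒ = Admissible⇒ admA
  module B⇒ = Admissible⇒ admB

  DX-m : DX m ≡ 0ℚ
  DX-m = trans (D-left m ℕ.≤-refl) A⇒.D-end

  largest-right : ∀ {P Q j} → m ≤ℕ j → (∀ q → P (m +ℕ q) → Q q) → (∀ q → Q q → P (m +ℕ q)) →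
                  X.Largest P j → Σ ℕ λ j′ → j ≡ m +ℕ j′ × B.Largest Q j′
  largest-right {P} {Q} {j} m≤j P⇒Q Q⇒P (j≤m+n , Pj , maxj) =
    j ∸ m , sym m+[j∸m]≡j ,
    ℕ.+-cancelˡ-≤ m _ _ (subst (_≤ℕ m +ℕ n) (sym m+[j∸m]≡j) j≤m+n) ,
    P⇒Q (j ∸ m) (subst P (sym m+[j∸m]≡j) Pj) ,
    λ q j∸m<q q≤n Qq → maxj (m +ℕ q) (subst (_<ℕ m +ℕ q) m+[j∸m]≡j (ℕ.+-monoʳ-< m j∸m<q))
                             (ℕ.+-monoʳ-≤ m q≤n) (Q⇒P q Qq)
    where
    m+[j∸m]≡j = ℕ.m+[n∸m]≡n m≤j

  fits-right⁻ : ∀ a r q → X.Fits (m +ℕ a) r (m +ℕ q) → B.Fits a r q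
  fits-right⁻ a r q (m+a≤m+q , fits) =
    ℕ.+-cancelˡ-≤ m _ _ m+a≤m+q , subst (_≤ r) (cong₂ _+_ (len-right a q) (D-right q)) fits

  fits-right⁺ : ∀ a r q → B.Fits a r q → X.Fits (m +ℕ a) r (m +ℕ q)
  fits-right⁺ a r q (a≤q , fits) =
    ℕ.+-monoʳ-≤ m a≤q , subst (_≤ r) (sym (cong₂ _+_ (len-right a q) (D-right q))) fits

  chain-right : ∀ a {c} → X.Chain (m +ℕ a) c → B.Chain a c
  chain-right a (X.stop m+a≡m+n) = B.stop (ℕ.+-cancelˡ-≡ m _ _ m+a≡m+n)
  chain-right a (X.next {j = j} {c = c} m+a≢m+n lg ch)
    with j′ , refl , lgB ← largest-right (ℕ.m+n≤o⇒m≤o m (proj₁ (proj₁ (proj₂ lg))))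
                                         (fits-right⁻ a _) (fits-right⁺ a _)
                                         (subst (λ d → X.Largest (X.Fits (m +ℕ a) (β - d)) j) (D-right a) lg)
    = subst (B.Chain a) cost≡ (B.next (λ a≡n → m+a≢m+n (cong (m +ℕ_) a≡n)) lgB (chain-right j′ ch))
    where
    cost≡ : DB a + lenB a j′ + DB j′ + c ≡ DX (m +ℕ a) + lenX (m +ℕ a) (m +ℕ j′) + DX (m +ℕ j′) + c
    cost≡ = sym (begin
      DX (m +ℕ a) + lenX (m +ℕ a) (m +ℕ j′) + DX (m +ℕ j′) + c
        ≡⟨ cong₂ (λ x y → x + y + DX (m +ℕ j′) + c) (D-right a) (len-right a j′) ⟩
      DB a + lenB a j′ + DX (m +ℕ j′) + c
        ≡⟨ cong (λ x → DB a + lenB a j′ + x + c) (D-right j′) ⟩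
      DB a + lenB a j′ + DB j′ + c ∎)
      where open ≡-Reasoning

  fits-left⁻ : ∀ a r p → p ≤ℕ m → X.Fits a r p → A.Fits a r p
  fits-left⁻ a r p p≤m (a≤p , fits) =
    a≤p , subst (_≤ r) (cong₂ _+_ (len-left a p a≤p p≤m) (D-left p p≤m)) fits

  fits-left⁺ : ∀ a r p → p ≤ℕ m → A.Fits a r p → X.Fits a r p
  fits-left⁺ a r p p≤m (a≤p , fits) =
    a≤p , subst (_≤ r) (sym (cong₂ _+_ (len-left a p a≤p p≤m) (D-left p p≤m))) fits

  lenX-across : ∀ a q → a ≤ℕ m → lenX a (m +ℕ q) + DX (m +ℕ q) ≡ lenA a m + (lenB 0 q + DB q)
  lenX-across a q a≤m = trans (cong₂ _+_ (len-across a q a≤m) (D-right q)) (ℚ.+-assoc (lenA a m) _ _)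

  fits-across⁻ : ∀ a r q → a ≤ℕ m → X.Fits a r (m +ℕ q) → B.Fits 0 (r - lenA a m) q
  fits-across⁻ a r q a≤m (_ , fits) = z≤n , p+q≤r⇒q≤r-p (subst (_≤ r) (lenX-across a q a≤m) fits)

  fits-across⁺ : ∀ a r q → a ≤ℕ m → B.Fits 0 (r - lenA a m) q → X.Fits a r (m +ℕ q)
  fits-across⁺ a r q a≤m (_ , fits) =
    ℕ.≤-trans a≤m (ℕ.m≤m+n m q) , subst (_≤ r) (sym (lenX-across a q a≤m)) (q≤r-p⇒p+q≤r fits)

  -- Going beyond the gluing point costs at least as much as stopping there, since D m = 0.
  fits-across⇒fits-end : ∀ a r q → a ≤ℕ m → X.Fits a r (m +ℕ q) → A.Fits a r m
  fits-across⇒fits-end a r q a≤m (_ , fits) = a≤m , ℚ.≤-trans stop≤go fits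
    where
    stop≤go : lenA a m + DA m ≤ lenX a (m +ℕ q) + DX (m +ℕ q)
    stop≤go = subst₂ _≤_ (sym (trans (cong (lenA a m +_) A⇒.D-end) (ℚ.+-identityʳ (lenA a m))))
                         (sym (lenX-across a q a≤m))
                         (p≤p+q (ℚ.+-mono-≤ (B⇒.len-nonNeg 0 q) (B⇒.D-nonNeg q)))

  largest-left : ∀ a r j → a ≤ℕ m → j <ℕ m → A.Largest (A.Fits a r) j → X.Largest (X.Fits a r) j
  largest-left a r j a≤m j<m (j≤m , fits-j , maxj) =
    ℕ.≤-trans j≤m (ℕ.m≤m+n m n) , fits-left⁺ a r j j≤m fits-j , maxX
    where
    maxX : ∀ p → j <ℕ p → p ≤ℕ m +ℕ n → ¬ X.Fits a r p
    maxX p j<p _ fits-p with ℕ.≤-total p m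
    ... | inj₁ p≤m = maxj p j<p p≤m (fits-left⁻ a r p p≤m fits-p)
    ... | inj₂ m≤p = maxj m j<m ℕ.≤-refl
      (fits-across⇒fits-end a r (p ∸ m) a≤m (subst (X.Fits a r) (sym (ℕ.m+[n∸m]≡n m≤p)) fits-p))

  RunOfB : ℚ → Set
  RunOfB c = Σ ℚ λ r → 0ℚ ≤ r × r ≤ β × B.Run 0 r c

  ChainSplits : ℕ → ℚ → Set
  ChainSplits a c = Σ ℚ λ c₁ → Σ ℚ λ c₂ → A.Chain a c₁ × RunOfB c₂ × c ≡ c₁ + c₂

  RunSplits : ℕ → ℚ → ℚ → Set
  RunSplits a r c = Σ ℚ λ c₁ → Σ ℚ λ c₂ → A.Run a r c₁ × RunOfB c₂ × c ≡ c₁ + c₂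

  m≤largest : ∀ {a r j} → X.Largest (X.Fits a r) j → A.Fits a r m → m ≤ℕ j
  m≤largest {a} {r} (_ , _ , maxj) fits-m =
    ℕ.≮⇒≥ (λ j<m → maxj m j<m (ℕ.m≤m+n m n) (fits-left⁺ a r m ℕ.≤-refl fits-m))

  lenX-from-end : ∀ q → lenX m (m +ℕ q) ≡ lenB 0 q
  lenX-from-end q = trans (len-across m q ℕ.≤-refl) (trans (cong (_+ lenB 0 q) (A⇒.len-refl m)) (ℚ.+-identityˡ _))

  fits-from-end⁻ : ∀ r q → X.Fits m r (m +ℕ q) → B.Fits 0 r q
  fits-from-end⁻ r q (_ , fits) = z≤n , subst (_≤ r) (cong₂ _+_ (lenX-from-end q) (D-right q)) fits

  fits-from-end⁺ : ∀ r q → B.Fits 0 r q → X.Fits m r (m +ℕ q)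
  fits-from-end⁺ r q (_ , fits) = ℕ.m≤m+n m q , subst (_≤ r) (sym (cong₂ _+_ (lenX-from-end q) (D-right q))) fits

  DX-nonNeg : ∀ a → a ≤ℕ m → 0ℚ ≤ DX a
  DX-nonNeg a a≤m = subst (0ℚ ≤_) (sym (D-left a a≤m)) (A⇒.D-nonNeg a)

  0≤β-DX-m : 0ℚ ≤ β - DX m
  0≤β-DX-m = ℚ.≤-trans (ℚ.≤-reflexive (sym DX-m))
    (subst (λ d → d ≤ β - d) (sym (D-left m ℕ.≤-refl)) (p+q≤r⇒q≤r-p (A⇒.round-trip m ℕ.≤-refl)))

  mutual
    chain-split : ∀ a {c} → a ≤ℕ m → X.Chain a c → ChainSplits a c
    chain-split a a≤m (X.stop a≡m+n) = 0ℚ , 0ℚ , A.stop a≡m , (β , A⇒.0≤β , ℚ.≤-refl , trivial-run) , refl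
      where
      n≡0 : n ≡ 0
      n≡0 = ℕ.n≤0⇒n≡0 (ℕ.+-cancelˡ-≤ m n 0 (subst₂ _≤ℕ_ a≡m+n (sym (ℕ.+-identityʳ m)) a≤m))
      a≡m : a ≡ m
      a≡m = trans a≡m+n (trans (cong (m +ℕ_) n≡0) (ℕ.+-identityʳ m))
      trivial-run : B.Run 0 β 0ℚ
      trivial-run =
        0 , 0ℚ ,
        (z≤n , B⇒.fits-self 0 (subst (_≤ β) (sym B⇒.D-start) B⇒.0≤β) ,
         λ p 0<p p≤n _ → ℕ.<⇒≱ 0<p (subst (p ≤ℕ_) n≡0 p≤n)) ,
        B.stop (sym n≡0) , sym (cong₂ (λ x y → x + y + 0ℚ) (B⇒.len-refl 0) B⇒.D-start)
    chain-split a a≤m (X.next {j = j} {c = c′} a≢m+n lg ch) with ℕ.m≤n⇒m<n∨m≡n a≤m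
    ... | inj₁ a<m = extend (run-split a (β - DX a) a≤m DAa≤r (p-q≤p (DX-nonNeg a a≤m)) lg ch)
      where
      DAa≤r : DA a ≤ β - DX a
      DAa≤r = subst (λ d → DA a ≤ β - d) (sym (D-left a a≤m)) (p+q≤r⇒q≤r-p (A⇒.round-trip a a≤m))
      extend : RunSplits a (β - DX a) (lenX a j + DX j + c′) → ChainSplits a (DX a + lenX a j + DX j + c′)
      extend (c₁ , c₂ , runA , runB , c≡) =
        DA a + c₁ , c₂ ,
        A.next′ (λ a≡m → ℕ.<-irrefl a≡m a<m) (subst (λ d → A.Run a (β - d) c₁) (D-left a a≤m) runA) ,
        runB , cost≡
        where
        cost≡ : DX a + lenX a j + DX j + c′ ≡ DA a + c₁ + c₂
        cost≡ = begin
          DX a + lenX a j + DX j + c′     ≡⟨ p+q+r+s≡p+[q+r+s] (DX a) (lenX a j) (DX j) c′ ⟩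
          DX a + (lenX a j + DX j + c′)   ≡⟨ cong₂ _+_ (D-left a a≤m) c≡ ⟩
          DA a + (c₁ + c₂)                ≡⟨ sym (ℚ.+-assoc (DA a) c₁ c₂) ⟩
          DA a + c₁ + c₂                  ∎
          where open ≡-Reasoning
    ... | inj₂ refl
      with j′ , refl , lgB ← largest-right (proj₁ (proj₁ (proj₂ lg))) (fits-from-end⁻ _) (fits-from-end⁺ _) lg
      = 0ℚ , lenB 0 j′ + DB j′ + c′ , A.stop refl ,
        (β - DX m , 0≤β-DX-m , p-q≤p (DX-nonNeg m ℕ.≤-refl) , (j′ , c′ , lgB , chain-right j′ ch , refl)) ,
        cost≡
      where
      cost≡ : DX m + lenX m (m +ℕ j′) + DX (m +ℕ j′) + c′ ≡ 0ℚ + (lenB 0 j′ + DB j′ + c′)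
      cost≡ = begin
        DX m + lenX m (m +ℕ j′) + DX (m +ℕ j′) + c′
          ≡⟨ cong₂ (λ x y → x + y + DX (m +ℕ j′) + c′) DX-m (lenX-from-end j′) ⟩
        0ℚ + lenB 0 j′ + DX (m +ℕ j′) + c′
          ≡⟨ cong (λ x → 0ℚ + lenB 0 j′ + x + c′) (D-right j′) ⟩
        0ℚ + lenB 0 j′ + DB j′ + c′
          ≡⟨ p+q+r+s≡p+[q+r+s] 0ℚ (lenB 0 j′) (DB j′) c′ ⟩
        0ℚ + (lenB 0 j′ + DB j′ + c′) ∎
        where open ≡-Reasoning

    run-split : ∀ a r {j c′} → a ≤ℕ m → DA a ≤ r → r ≤ β → X.Largest (X.Fits a r) j → X.Chain j c′ →
                RunSplits a r (lenX a j + DX j + c′)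
    run-split a r a≤m DAa≤r r≤β lg ch
      with jA , lgA ← A.largest-exists (A.fits? a r) a a≤m (A⇒.fits-self a DAa≤r)
      with ℕ.m≤n⇒m<n∨m≡n (proj₁ lgA)
    ... | inj₁ jA<m = run-split-before a r jA a≤m jA<m lgA lg ch
    ... | inj₂ refl = run-split-end a r a≤m r≤β lgA lg ch

    run-split-before : ∀ a r jA {j c′} → a ≤ℕ m → jA <ℕ m → A.Largest (A.Fits a r) jA →
                       X.Largest (X.Fits a r) j → X.Chain j c′ → RunSplits a r (lenX a j + DX j + c′)
    run-split-before a r jA {c′ = c′} a≤m jA<m lgA@(jA≤m , fits-jA , _) lg ch
      with refl ← X.largest-unique lg (largest-left a r jA a≤m jA<m lgA)
      = extend (chain-split jA jA≤m ch)
      where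
      extend : ChainSplits jA c′ → RunSplits a r (lenX a jA + DX jA + c′)
      extend (c₁ , c₂ , chA , runB , c′≡) =
        lenA a jA + DA jA + c₁ , c₂ , (jA , c₁ , lgA , chA , refl) , runB , cost≡
        where
        cost≡ : lenX a jA + DX jA + c′ ≡ lenA a jA + DA jA + c₁ + c₂
        cost≡ = begin
          lenX a jA + DX jA + c′          ≡⟨ cong₂ (λ x y → x + y + c′) (len-left a jA (proj₁ fits-jA) jA≤m)
                                                                       (D-left jA jA≤m) ⟩
          lenA a jA + DA jA + c′          ≡⟨ cong (lenA a jA + DA jA +_) c′≡ ⟩
          lenA a jA + DA jA + (c₁ + c₂)   ≡⟨ sym (ℚ.+-assoc (lenA a jA + DA jA) c₁ c₂) ⟩
          lenA a jA + DA jA + c₁ + c₂     ∎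
          where open ≡-Reasoning

    run-split-end : ∀ a r {j c′} → a ≤ℕ m → r ≤ β → A.Largest (A.Fits a r) m →
                    X.Largest (X.Fits a r) j → X.Chain j c′ → RunSplits a r (lenX a j + DX j + c′)
    run-split-end a r {j} {c′} a≤m r≤β lgA@(_ , fits-m , _) lg ch =
      let j′ , j≡m+j′ , lgB = largest-right (m≤largest lg fits-m)
                                (λ q → fits-across⁻ a r q a≤m) (λ q → fits-across⁺ a r q a≤m) lg
      in subst (λ k → RunSplits a r (lenX a k + DX k + c′)) (sym j≡m+j′)
           (splits j′ lgB (subst (λ k → X.Chain k c′) j≡m+j′ ch))
      where
      0≤r′ : 0ℚ ≤ r - lenA a m
      0≤r′ = p+q≤r⇒q≤r-p (subst (λ d → lenA a m + d ≤ r) A⇒.D-end (proj₂ fits-m))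
      stop-cost : lenA a m + DA m + 0ℚ ≡ lenA a m
      stop-cost = trans (ℚ.+-identityʳ _) (trans (cong (lenA a m +_) A⇒.D-end) (ℚ.+-identityʳ _))
      splits : ∀ j′ → B.Largest (B.Fits 0 (r - lenA a m)) j′ → X.Chain (m +ℕ j′) c′ →
               RunSplits a r (lenX a (m +ℕ j′) + DX (m +ℕ j′) + c′)
      splits j′ lgB ch′ =
        lenA a m + DA m + 0ℚ , lenB 0 j′ + DB j′ + c′ , (m , 0ℚ , lgA , A.stop refl , refl) ,
        (r - lenA a m , 0≤r′ , ℚ.≤-trans (p-q≤p (A⇒.len-nonNeg a m)) r≤β ,
         (j′ , c′ , lgB , chain-right j′ ch′ , refl)) ,
        (begin
          lenX a (m +ℕ j′) + DX (m +ℕ j′) + c′              ≡⟨ cong (_+ c′) (lenX-across a j′ a≤m) ⟩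
          lenA a m + (lenB 0 j′ + DB j′) + c′               ≡⟨ ℚ.+-assoc (lenA a m) (lenB 0 j′ + DB j′) c′ ⟩
          lenA a m + (lenB 0 j′ + DB j′ + c′)               ≡⟨ cong (_+ (lenB 0 j′ + DB j′ + c′)) (sym stop-cost) ⟩
          lenA a m + DA m + 0ℚ + (lenB 0 j′ + DB j′ + c′)   ∎)
        where open ≡-Reasoning

  maxRunCost-split : ∀ {c c₁ c₂} → X.MaxRunCost c → A.MaxRunCost c₁ → B.MaxRunCost c₂ → c ≤ c₁ + c₂
  maxRunCost-split ((B′ , 0≤B′ , B′≤β , (j , c′ , lg , ch , refl)) , _) (_ , maxA) (_ , maxB)
    with c₁ , c₂ , runA , (r , 0≤r , r≤β , runB) , c≡
           ← run-split 0 B′ z≤n (subst (_≤ B′) (sym A⇒.D-start) 0≤B′) B′≤β lg ch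
    = subst (_≤ _) (sym c≡) (ℚ.+-mono-≤ (maxA B′ c₁ 0≤B′ B′≤β runA) (maxB r c₂ 0≤r r≤β runB))


-- Adversarial DFS on trees

-- ADFS.at looks v_p up with a where-bound helper that cannot be named; abstracting the
-- helper's list and index arguments turns the goal into an instance of lookupOr-unique.
at≡lookupOr : ∀ t β p → ADFS.at t β p ≡ lookupOr [] (dfs t) p
at≡lookupOr (node cs) β zero    = refl
at≡lookupOr (node cs) β (suc p) with suc p
... | _ with lookupOr-unique (λ _ → refl) (λ _ _ → refl) (λ _ _ _ → refl) | dfsL 0 cs | p
... | unique | xs | n = unique xs n

mutual
  dfs≡tour : ∀ t → dfs t ≡ tour t (whole t)
  dfs≡tour (node cs) = cong ([] ∷_) (dfsL≡tourL 0 cs)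

  dfsL≡tourL : ∀ i cs → dfsL i cs ≡ tourL i cs (wholeL cs)
  dfsL≡tourL i []             = refl
  dfsL≡tourL i ((w , t) ∷ cs) = cong₂ (λ a b → map (i ∷_) a ++ ([] ∷ b)) (dfs≡tour t) (dfsL≡tourL (suc i) cs)

dfsSteps : Tree → List ℚ
dfsSteps t = tourSteps t (whole t)

dfs-path : ∀ t → Path t [] [] (dfs t) (dfsSteps t)
dfs-path t = subst (λ vs → Path t [] [] vs (dfsSteps t)) (sym (dfs≡tour t)) (tour-path t (whole t))

module TreeModel (β : ℚ) (t : Tree) where

  open ADFS t β using (l; at; slice)

  D : ℕ → ℚ
  D p = depth t (at p)

  len : ℕ → ℕ → ℚ
  len a p = sumℚ (take (p ∸ a) (drop a (dfsSteps t)))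

  l≡length : l ≡ length (dfsSteps t)
  l≡length = cong (_∸ 1) (path-length (dfs-path t))

  walk-slice : ∀ a p → a ≤ℕ p → p ≤ℕ l → Walk t (slice a p) (len a p)
  walk-slice a p a≤p p≤l =
    subst (λ n → Walk t (take n (drop a (dfs t))) (len a p)) (sym (ℕ.+-∸-assoc 1 a≤p))
      (path⇒walk (proj₂ (path-take (p ∸ a) p∸a≤ (proj₂ (path-drop a a≤ (dfs-path t))))))
    where
    p≤ = subst (p ≤ℕ_) l≡length p≤l
    a≤ = ℕ.≤-trans a≤p p≤
    p∸a≤ = subst (p ∸ a ≤ℕ_) (sym (List.length-drop a (dfsSteps t))) (ℕ.∸-monoˡ-≤ a p≤)

  walk-slice-unique : ∀ a p {L} → a ≤ℕ p → p ≤ℕ l → Walk t (slice a p) L → L ≡ len a p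
  walk-slice-unique a p a≤p p≤l walk = walk-length-unique walk (walk-slice a p a≤p p≤l)

  at≡ : ∀ p → at p ≡ lookupOr [] (dfs t) p
  at≡ = at≡lookupOr t β

  at-vertex : ∀ p → Vertex t (at p)
  at-vertex p = subst (Vertex t) (sym (at≡ p)) (lookupOr-all (dfs t) p (path-vertices (dfs-path t)) (t , refl))

  D-start : D 0 ≡ 0ℚ
  D-start = cong (depth t) (trans (at≡ 0) (dfs-head t))
    where
    dfs-head : ∀ t → lookupOr [] (dfs t) 0 ≡ []
    dfs-head (node _) = refl

  D-end : D l ≡ 0ℚ
  D-end = cong (depth t) (trans (at≡ l) (lookupOr-last (dfs t) (path-last (dfs-path t))))

  len-step : ∀ p → p <ℕ l → len p (suc p) ≡ lookupOr 0ℚ (dfsSteps t) p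
  len-step p p<l = trans (cong (λ n → sumℚ (take n (drop p (dfsSteps t)))) (ℕ.m+n∸n≡m 1 p))
    (trans (cong sumℚ (take-1-drop (dfsSteps t) p (subst (p <ℕ_) l≡length p<l))) (ℚ.+-identityʳ _))

  step-at : ∀ p → p <ℕ l → Step t (at p) (at (suc p)) (len p (suc p))
  step-at p p<l = subst₂ (λ x y → Step t x y (len p (suc p))) (sym (at≡ p)) (sym (at≡ (suc p)))
    (subst (Step t _ _) (sym (len-step p p<l)) (path-step (dfs-path t) p (subst (p <ℕ_) l≡length p<l)))

  module _ (nn : NonNegWeights t) (explorable : Explorable β t) where

    -- One of two consecutive vertices is the parent of the other, so the step fits in a
    -- round trip to the deeper one.
    step-within : ∀ p → p <ℕ l → D p + len p (suc p) + D (suc p) ≤ β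
    step-within p p<l with step-depth (step-at p p<l)
    ... | inj₁ deeper = subst (λ d → d + D (suc p) ≤ β) deeper (explorable (at (suc p)) (at-vertex (suc p)))
    ... | inj₂ higher = subst (_≤ β) (rearrange higher) (explorable (at p) (at-vertex p))
      where
      rearrange : D p ≡ D (suc p) + len p (suc p) → D p + D p ≡ D p + len p (suc p) + D (suc p)
      rearrange eq = trans (cong (D p +_) (trans eq (ℚ.+-comm (D (suc p)) _))) (sym (ℚ.+-assoc (D p) _ _))

    admissible : Admissible β l D len
    admissible = record
      { len-refl    = λ a → cong (λ n → sumℚ (take n (drop a (dfsSteps t)))) (ℕ.n∸n≡0 a)
      ; len-nonNeg  = λ a p → sumℚ-nonNeg (Allₚ.take⁺ (p ∸ a) (Allₚ.drop⁺ a (tourSteps-nonNeg t (whole t) nn)))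
      ; D-nonNeg    = λ p → depth-nonNeg t (at p) nn
      ; D-start     = D-start
      ; D-end       = D-end
      ; round-trip  = λ p _ → explorable (at p) (at-vertex p)
      ; step-within = step-within
      }

-- The conditions of ADFS t β ask for some walk along a slice of the DFS; as walk lengths are
-- unique, they amount to the corresponding Fits of the model.
module TreeADFS (β : ℚ) (t : Tree) where

  open TreeModel β t
  module AD = ADFS t β
  open AD using (l; Cond₁; Cond)
  open ADFSModel β l D len


  private
    largest⁺ : ∀ {P Q : ℕ → Set} {j} →
               (∀ p → p ≤ℕ l → P p → Q p) → (∀ p → p ≤ℕ l → Q p → P p) → AD.Largest P j → Largest Q j
    largest⁺ P⇒Q Q⇒P (j≤l , Pj , maxj) =
      j≤l , P⇒Q _ j≤l Pj , λ p j<p p≤l Qp → maxj p j<p p≤l (Q⇒P p p≤l Qp)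

    largest⁻ : ∀ {P Q : ℕ → Set} {j} →
               (∀ p → p ≤ℕ l → P p → Q p) → (∀ p → p ≤ℕ l → Q p → P p) → Largest Q j → AD.Largest P j
    largest⁻ P⇒Q Q⇒P (j≤l , Qj , maxj) =
      j≤l , Q⇒P _ j≤l Qj , λ p j<p p≤l Pp → maxj p j<p p≤l (P⇒Q p p≤l Pp)

  cond₁⇒fits : ∀ B′ p → p ≤ℕ l → Cond₁ B′ p → Fits 0 B′ p
  cond₁⇒fits B′ p p≤l (L , walk , fits) =
    z≤n , subst (λ L → L + D p ≤ B′) (walk-slice-unique 0 p z≤n p≤l walk) fits

  fits⇒cond₁ : ∀ B′ p → p ≤ℕ l → Fits 0 B′ p → Cond₁ B′ p
  fits⇒cond₁ B′ p p≤l (_ , fits) = len 0 p , walk-slice 0 p z≤n p≤l , fits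

  cond⇒fits : ∀ a p → p ≤ℕ l → Cond a p → Fits a (β - D a) p
  cond⇒fits a p p≤l (a≤p , L , walk , fits) =
    a≤p , p+q≤r⇒q≤r-p (subst (_≤ β) (ℚ.+-assoc (D a) _ _)
                                 (subst (λ L → D a + L + D p ≤ β) (walk-slice-unique a p a≤p p≤l walk) fits))

  fits⇒cond : ∀ a p → p ≤ℕ l → Fits a (β - D a) p → Cond a p
  fits⇒cond a p p≤l (a≤p , fits) =
    a≤p , len a p , walk-slice a p a≤p p≤l , subst (_≤ β) (sym (ℚ.+-assoc (D a) _ _)) (q≤r-p⇒p+q≤r fits)

  chain⁺ : ∀ {a c} → AD.Chain a c → Chain a c
  chain⁺ (AD.stop a≡l) = stop a≡l
  chain⁺ (AD.next {a} {j} {L} {c} a≢l lg@(j≤l , (a≤j , _) , _) walk ch) =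
    subst (λ L → Chain a (D a + L + D j + c)) (sym (walk-slice-unique a j a≤j j≤l walk))
      (next a≢l (largest⁺ (cond⇒fits a) (fits⇒cond a) lg) (chain⁺ ch))

  chain⁻ : ∀ {a c} → Chain a c → AD.Chain a c
  chain⁻ (stop a≡l) = AD.stop a≡l
  chain⁻ (next {a} {j} a≢l lg@(j≤l , (a≤j , _) , _) ch) =
    AD.next a≢l (largest⁻ (cond⇒fits a) (fits⇒cond a) lg) (walk-slice a j a≤j j≤l) (chain⁻ ch)

  costB′⇒run : ∀ B′ c → AD.CostB′ B′ c → Run 0 B′ c
  costB′⇒run B′ c (j , L , c′ , lg , walk , ch , c≡) =
    j , c′ , largest⁺ (cond₁⇒fits B′) (fits⇒cond₁ B′) lg , chain⁺ ch ,
    trans c≡ (cong (λ L → L + D j + c′) (walk-slice-unique 0 j z≤n (proj₁ lg) walk))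

  run⇒costB′ : ∀ B′ c → Run 0 B′ c → AD.CostB′ B′ c
  run⇒costB′ B′ c (j , c′ , lg , ch , c≡) =
    j , len 0 j , c′ , largest⁻ (cond₁⇒fits B′) (fits⇒cond₁ B′) lg , walk-slice 0 j z≤n (proj₁ lg) , chain⁻ ch , c≡

  isADFSCost⇒maxRunCost : ∀ {c} → IsADFSCost β t c → MaxRunCost c
  isADFSCost⇒maxRunCost ((B′ , 0≤B′ , B′≤β , cost) , maximal) =
    (B′ , 0≤B′ , B′≤β , costB′⇒run B′ _ cost) ,
    λ B″ c′ 0≤B″ B″≤β run → maximal B″ c′ 0≤B″ B″≤β (run⇒costB′ B″ c′ run)

  maxRunCost⇒isADFSCost : ∀ {c} → MaxRunCost c → IsADFSCost β t c
  maxRunCost⇒isADFSCost ((B′ , 0≤B′ , B′≤β , run) , maximal) =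
    (B′ , 0≤B′ , B′≤β , run⇒costB′ B′ _ run) ,
    λ B″ c′ 0≤B″ B″≤β cost → maximal B″ c′ 0≤B″ B″≤β (costB′⇒run B″ c′ cost)

  adfsCost-exists : NonNegWeights t → Explorable β t → Σ ℚ (IsADFSCost β t)
  adfsCost-exists nn explorable =
    let c , max = Admissible⇒.maximal-run (admissible nn explorable) in c , maxRunCost⇒isADFSCost max

shift : Pos → Pos
shift []      = []
shift (k ∷ x) = suc k ∷ x

dfsL-shift : ∀ i cs → dfsL (suc i) cs ≡ map shift (dfsL i cs)
dfsL-shift i []             = refl
dfsL-shift i ((w , t) ∷ cs) =
  trans (cong₂ (λ a b → a ++ ([] ∷ b)) (List.map-∘ (dfs t)) (dfsL-shift (suc i) cs))
        (sym (List.map-++ shift (map (i ∷_) (dfs t)) ([] ∷ dfsL (suc i) cs)))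

module ADFSFirstEdge (β w : ℚ) (t : Tree) (es : List (ℚ × Tree)) where

  T₁ = edgeTree (w , t)
  T₂ = node es
  T  = node ((w , t) ∷ es)

  module M₁ = TreeModel β T₁
  module M₂ = TreeModel β T₂
  module M  = TreeModel β T

  m = ADFS.l T₁ β
  n = ADFS.l T₂ β
  s₁ = dfsSteps T₁
  s₂ = dfsSteps T₂

  -- The DFS of T runs through T₁ except for its final return to the root, then through T₂;
  -- dfs T₁ is prefix ++ [ [] ] by definition.
  prefix : List Pos
  prefix = [] ∷ map (0 ∷_) (dfs t)

  dfs-T : dfs T ≡ prefix ++ map shift (dfs T₂)
  dfs-T = cong (λ xs → [] ∷ (map (0 ∷_) (dfs t) ++ ([] ∷ xs))) (dfsL-shift 0 es)

  length-prefix : length prefix ≡ m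
  length-prefix = sym (trans (List.length-++ (map (0 ∷_) (dfs t))) (ℕ.+-comm _ 1))

  steps-T : dfsSteps T ≡ s₁ ++ s₂
  steps-T = cong (w ∷_) (sym (List.++-assoc (dfsSteps t) [ w ] s₂))

  l-split : ADFS.l T β ≡ m +ℕ n
  l-split = begin
    ADFS.l T β                ≡⟨ M.l≡length ⟩
    length (dfsSteps T)       ≡⟨ cong length steps-T ⟩
    length (s₁ ++ s₂)         ≡⟨ List.length-++ s₁ ⟩
    length s₁ +ℕ length s₂    ≡⟨ sym (cong₂ _+ℕ_ M₁.l≡length M₂.l≡length) ⟩
    m +ℕ n                    ∎
    where open ≡-Reasoning

  depth-shift : ∀ x → depth T (shift x) ≡ depth T₂ x
  depth-shift []      = refl
  depth-shift (k ∷ x) = refl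

  D-right : ∀ q → M.D (m +ℕ q) ≡ M₂.D q
  D-right q = begin
    depth T (ADFS.at T β (m +ℕ q))
      ≡⟨ cong (depth T) (M.at≡ (m +ℕ q)) ⟩
    depth T (lookupOr [] (dfs T) (m +ℕ q))
      ≡⟨ cong₂ (λ xs k → depth T (lookupOr [] xs (k +ℕ q))) dfs-T (sym length-prefix) ⟩
    depth T (lookupOr [] (prefix ++ map shift (dfs T₂)) (length prefix +ℕ q))
      ≡⟨ cong (depth T) (lookupOr-++ʳ prefix _ q) ⟩
    depth T (lookupOr [] (map shift (dfs T₂)) q)
      ≡⟨ cong (depth T) (lookupOr-map shift (dfs T₂) q refl) ⟩
    depth T (shift (lookupOr [] (dfs T₂) q))
      ≡⟨ depth-shift (lookupOr [] (dfs T₂) q) ⟩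
    depth T₂ (lookupOr [] (dfs T₂) q)
      ≡⟨ cong (depth T₂) (sym (M₂.at≡ q)) ⟩
    depth T₂ (ADFS.at T₂ β q) ∎
    where open ≡-Reasoning

  D-left : ∀ p → p ≤ℕ m → M.D p ≡ M₁.D p
  D-left p p≤m with ℕ.m≤n⇒m<n∨m≡n p≤m
  ... | inj₂ refl = trans (subst (λ k → M.D k ≡ M₂.D 0) (ℕ.+-identityʳ m) (D-right 0))
                          (trans M₂.D-start (sym M₁.D-end))
  ... | inj₁ p<m = begin
    depth T (ADFS.at T β p)
      ≡⟨ cong (depth T) (trans (M.at≡ p) (cong (λ xs → lookupOr [] xs p) dfs-T)) ⟩
    depth T (lookupOr [] (prefix ++ map shift (dfs T₂)) p)
      ≡⟨ cong (depth T) (lookupOr-++ˡ prefix _ p p<|prefix|) ⟩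
    depth T (lookupOr [] prefix p)
      ≡⟨ lookupOr-all prefix p same-depth refl ⟩
    depth T₁ (lookupOr [] prefix p)
      ≡⟨ cong (depth T₁) (sym (lookupOr-++ˡ prefix [ [] ] p p<|prefix|)) ⟩
    depth T₁ (lookupOr [] (dfs T₁) p)
      ≡⟨ cong (depth T₁) (sym (M₁.at≡ p)) ⟩
    depth T₁ (ADFS.at T₁ β p) ∎
    where
    open ≡-Reasoning
    p<|prefix| = subst (p <ℕ_) (sym length-prefix) p<m
    same-depth : All (λ x → depth T x ≡ depth T₁ x) prefix
    same-depth = refl ∷ Allₚ.map⁺ (All.universal (λ _ → refl) (dfs t))

  m≡|s₁| : m ≡ length s₁
  m≡|s₁| = M₁.l≡length

  len-right : ∀ a p → M.len (m +ℕ a) (m +ℕ p) ≡ M₂.len a p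
  len-right a p = cong sumℚ (begin
    take (m +ℕ p ∸ (m +ℕ a)) (drop (m +ℕ a) (dfsSteps T))
      ≡⟨ cong₂ take (ℕ.[m+n]∸[m+o]≡n∸o m p a) (cong₂ (λ k xs → drop (k +ℕ a) xs) m≡|s₁| steps-T) ⟩
    take (p ∸ a) (drop (length s₁ +ℕ a) (s₁ ++ s₂))
      ≡⟨ cong (take (p ∸ a)) (drop-++ʳ s₁ s₂ a) ⟩
    take (p ∸ a) (drop a s₂) ∎)
    where open ≡-Reasoning

  len-left : ∀ a p → a ≤ℕ p → p ≤ℕ m → M.len a p ≡ M₁.len a p
  len-left a p a≤p p≤m = cong sumℚ (begin
    take (p ∸ a) (drop a (dfsSteps T))  ≡⟨ cong (λ xs → take (p ∸ a) (drop a xs)) steps-T ⟩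
    take (p ∸ a) (drop a (s₁ ++ s₂))    ≡⟨ cong (take (p ∸ a)) (drop-++ˡ a s₁ s₂ (ℕ.≤-trans a≤p p≤|s₁|)) ⟩
    take (p ∸ a) (drop a s₁ ++ s₂)      ≡⟨ take-++ˡ (p ∸ a) (drop a s₁) s₂ p∸a≤ ⟩
    take (p ∸ a) (drop a s₁)            ∎)
    where
    open ≡-Reasoning
    p≤|s₁| = subst (p ≤ℕ_) m≡|s₁| p≤m
    p∸a≤ = subst (p ∸ a ≤ℕ_) (sym (List.length-drop a s₁)) (ℕ.∸-monoˡ-≤ a p≤|s₁|)

  len-across : ∀ a q → a ≤ℕ m → M.len a (m +ℕ q) ≡ M₁.len a m + M₂.len 0 q
  len-across a q a≤m = begin
    sumℚ (take (m +ℕ q ∸ a) (drop a (dfsSteps T)))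
      ≡⟨ cong (λ xs → sumℚ (take (m +ℕ q ∸ a) (drop a xs))) steps-T ⟩
    sumℚ (take (m +ℕ q ∸ a) (drop a (s₁ ++ s₂)))
      ≡⟨ cong₂ (λ k xs → sumℚ (take k xs)) m+q∸a≡ (drop-++ˡ a s₁ s₂ a≤|s₁|) ⟩
    sumℚ (take (length (drop a s₁) +ℕ q) (drop a s₁ ++ s₂))
      ≡⟨ cong sumℚ (take-++ʳ (drop a s₁) s₂ q) ⟩
    sumℚ (drop a s₁ ++ take q s₂)
      ≡⟨ sumℚ-++ (drop a s₁) (take q s₂) ⟩
    sumℚ (drop a s₁) + sumℚ (take q s₂)
      ≡⟨ cong (λ xs → sumℚ xs + sumℚ (take q s₂)) (sym (List.take-all (m ∸ a) (drop a s₁) (ℕ.≤-reflexive |drop|≡))) ⟩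
    sumℚ (take (m ∸ a) (drop a s₁)) + sumℚ (take q s₂) ∎
    where
    open ≡-Reasoning
    a≤|s₁| = subst (a ≤ℕ_) m≡|s₁| a≤m
    |drop|≡ : length (drop a s₁) ≡ m ∸ a
    |drop|≡ = trans (List.length-drop a s₁) (cong (_∸ a) (sym m≡|s₁|))
    m+q∸a≡ : m +ℕ q ∸ a ≡ length (drop a s₁) +ℕ q
    m+q∸a≡ = begin
      m +ℕ q ∸ a    ≡⟨ cong (_∸ a) (ℕ.+-comm m q) ⟩
      q +ℕ m ∸ a    ≡⟨ ℕ.+-∸-assoc q a≤m ⟩
      q +ℕ (m ∸ a)  ≡⟨ ℕ.+-comm q (m ∸ a) ⟩
      m ∸ a +ℕ q    ≡⟨ cong (_+ℕ q) (sym |drop|≡) ⟩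
      length (drop a s₁) +ℕ q ∎

  adfsCost-split : NonNegWeights T → Explorable β T → ∀ {c c₁ c₂} →
                   IsADFSCost β T c → IsADFSCost β T₁ c₁ → IsADFSCost β T₂ c₂ → c ≤ c₁ + c₂
  adfsCost-split nn explorable {c} cost cost₁ cost₂ =
    maxRunCost-split
      (subst (λ k → ADFSModel.MaxRunCost β k M.D M.len c) l-split (TreeADFS.isADFSCost⇒maxRunCost β T cost))
      (TreeADFS.isADFSCost⇒maxRunCost β T₁ cost₁)
      (TreeADFS.isADFSCost⇒maxRunCost β T₂ cost₂)
    where
    open Concatenation
      (M₁.admissible (nonNegWeights-head {w} {t} {es} nn) (explorable-head explorable))
      (M₂.admissible (nonNegWeights-tail {w} {t} {es} nn) (explorable-tail explorable))
      D-left D-right len-left len-across len-right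

adfsCost-leaf : ∀ {β c} → IsADFSCost β (node []) c → c ≤ 0ℚ
adfsCost-leaf {β} cost with TreeADFS.isADFSCost⇒maxRunCost β (node []) cost
... | (_ , _ , _ , _ , _ , (z≤n , _) , ADFSModel.stop _ , c≡) , _        = ℚ.≤-reflexive c≡
... | (_ , _ , _ , _ , _ , (z≤n , _) , ADFSModel.next 0≢0 _ _ , _) , _  = ⊥-elim (0≢0 refl)

adfsCost-children : ∀ β es → NonNegWeights (node es) → Explorable β (node es) →
  Σ ℚ λ c → Σ (List ℚ) λ cs →
    IsADFSCost β (node es) c × Pointwise (λ e cₑ → IsADFSCost β (edgeTree e) cₑ) es cs × c ≤ sumℚ cs
adfsCost-children β [] nn explorable =
  let c , cost = TreeADFS.adfsCost-exists β (node []) nn explorable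
  in c , [] , cost , [] , adfsCost-leaf cost
adfsCost-children β ((w , t) ∷ es) nn explorable
  with c₂ , cs , cost₂ , costs , c₂≤ ←
         adfsCost-children β es (nonNegWeights-tail {w} {t} {es} nn) (explorable-tail explorable)
  = let c  , cost  = TreeADFS.adfsCost-exists β T nn explorable
        c₁ , cost₁ = TreeADFS.adfsCost-exists β T₁ (nonNegWeights-head {w} {t} {es} nn) (explorable-head explorable)
    in c , c₁ ∷ cs , cost , cost₁ ∷ costs ,
       ℚ.≤-trans (adfsCost-split nn explorable cost cost₁ cost₂) (ℚ.+-monoʳ-≤ c₁ c₂≤)
  where open ADFSFirstEdge β w t es

lemma1 : (T : Tree) (B : ℚ) → PositiveWeights T → 1ℚ < B →
    (∀ x → Vertex T x → depth T x ≤ ½ * B) →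
    (v : Pos) (es : List (ℚ × Tree)) → sub T v ≡ just (node es) →
    (Σ ℚ (λ c → Σ (List ℚ) (λ cs →
        IsOptCost (budget B T v) (node es) c ×
        Pointwise (λ e ce → IsOptCost (budget B T v) (edgeTree e) ce) es cs ×
        c ≡ sumℚ cs)))
    ×
    (Σ ℚ (λ c → Σ (List ℚ) (λ cs →
        IsADFSCost (budget B T v) (node es) c ×
        Pointwise (λ e ce → IsADFSCost (budget B T v) (edgeTree e) ce) es cs ×
        c ≤ sumℚ cs)))
lemma1 T B positive _ bounded v es v∈T =
  (let c , cs , opt , opts , c≡ = optimalCost-children β es nn explorable
   in c , cs , isOptFamilyCost⇒isOptCost (node es) nn opt , opts , c≡) ,
  adfsCost-children β es nn explorable
  where
  β : ℚ
  β = budget B T v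
  nn : NonNegWeights (node es)
  nn = nonNegWeights-sub T v positive v∈T
  explorable : Explorable β (node es)
  explorable = explorable-sub T B v bounded v∈T
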